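{- Consider a two-stripe symmetric circulant TSP instance with parameters $n, a_1, a_2$ satisfying the standing assumptions below, and let $g_1=\gcd(n,a_1)$. Let $k<2(g_1-1)$ be an integer and let $x$ be the unique solution of $x a_1 \equiv -g_1 a_2 \pmod n$ in $\{0,1,\dots,\frac{n}{g_1}-1\}$. Then there exists a Hamiltonian cycle of cost $k$ in the instance if and only if there is a Hamiltonian path in the $r\times c$ cylinder graph with $c=g_1$ and $r=\frac{n}{g_1}$ that uses exactly $k-1$ horizontal edges, starts at $(0,0)$, and ends at $(x,c-1)$.
   Context: Two-stripe symmetric circulant TSP: the vertex set is $\mathbb{Z}_n$, and for two distinct integers $a_1,a_2\in\{1,\dots,\lfloor n/2\rfloor\}$ the only finite-cost edges are $\{v,v\pm a_1 \bmod n\}$ (cost $0$) and $\{v,v\pm a_2\bmod n\}$ (cost $1$); the cost of a Hamiltonian cycle is its number of edges of length $a_2$. Standing assumptions: $g_1=\gcd(n,a_1)>1$ and $\gcd(n,a_1,a_2)=1$. An $r\times c$ cylinder graph has vertices $(i,j)$, $0\le i\le r-1$, $0\le j\le c-1$; vertex $(i,j)$ is adjacent to $(i,j+1)$ if $j<c-1$ and to $(i,j-1)$ if $j>0$ (these are horizontal edges, cost $1$), and to $(i-1 \bmod r, j)$ and $(i+1\bmod r,j)$ (vertical edges, cost $0$). -}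

module Defs where

open import Data.Nat using (ℕ; zero; suc; _+_; _*_; _∸_; _≟_)
open import Data.Nat.Properties using ()
open import Data.Fin using (Fin; toℕ; inject₁; fromℕ) renaming (zero to fzero; suc to fsuc)
open import Data.List using (List; []; _∷_; _++_; map; length; filter; allFin)
open import Data.List.Relation.Unary.All using (All)
open import Data.Product using (Σ; _×_; _,_; proj₁; proj₂)
open import Data.Sum using (_⊎_)
open import Relation.Nullary using (Dec; yes; no)
open import Relation.Nullary.Decidable using (_⊎-dec_; _×-dec_)
open import Relation.Binary.PropositionalEquality using (_≡_)
open import Function.Definitions using (Injective)

-- Modular step.  For u, v < m and d ≤ m,
--   StepMod m d u v   holds  iff  v ≡ u + d  (mod m).
-- (u + d < 2m, so u + d ≡ v (mod m) iff u + d = v or u + d = v + m.)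

StepMod : ℕ → ℕ → ℕ → ℕ → Set
StepMod m d u v = (u + d ≡ v) ⊎ (u + d ≡ v + m)

stepMod? : ∀ m d u v → Dec (StepMod m d u v)
stepMod? m d u v = (u + d ≟ v) ⊎-dec (u + d ≟ v + m)

CircEdge : (n a : ℕ) → Fin n → Fin n → Set
CircEdge n a u v = StepMod n a (toℕ u) (toℕ v) ⊎ StepMod n a (toℕ v) (toℕ u)

circEdge? : ∀ n a (u v : Fin n) → Dec (CircEdge n a u v)
circEdge? n a u v = stepMod? n a (toℕ u) (toℕ v) ⊎-dec stepMod? n a (toℕ v) (toℕ u)

cycleEdges : ∀ {A : Set} L → (Fin (suc L) → A) → List (A × A)
cycleEdges L σ = map (λ i → σ (inject₁ i) , σ (fsuc i)) (allFin L) ++ ((σ (fromℕ L) , σ fzero) ∷ [])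

pathEdges : ∀ {A : Set} L → (Fin (suc L) → A) → List (A × A)
pathEdges L σ = map (λ i → σ (inject₁ i) , σ (fsuc i)) (allFin L)

-- The cycle is the cyclic sequence σ 0, …, σ L of all n = L+1 vertices,
-- each visited exactly once (σ injective, hence bijective).
HamCycleOfCost : (n a₁ a₂ k : ℕ) → Set
HamCycleOfCost n a₁ a₂ k =
  Σ ℕ λ L → Σ (suc L ≡ n) λ _ →
  Σ (Fin (suc L) → Fin n) λ σ →
      Injective _≡_ _≡_ σ
    × All (λ e → CircEdge n a₁ (proj₁ e) (proj₂ e) ⊎ CircEdge n a₂ (proj₁ e) (proj₂ e))
          (cycleEdges L σ)
    × length (filter (λ e → circEdge? n a₂ (proj₁ e) (proj₂ e)) (cycleEdges L σ)) ≡ k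

CylVertex : ℕ → ℕ → Set
CylVertex r c = Fin r × Fin c

Horiz : ∀ {r c} → CylVertex r c → CylVertex r c → Set
Horiz (i , j) (i' , j') = (toℕ i ≡ toℕ i') × ((suc (toℕ j) ≡ toℕ j') ⊎ (suc (toℕ j') ≡ toℕ j))

horiz? : ∀ {r c} (p q : CylVertex r c) → Dec (Horiz p q)
horiz? (i , j) (i' , j') = (toℕ i ≟ toℕ i') ×-dec ((suc (toℕ j) ≟ toℕ j') ⊎-dec (suc (toℕ j') ≟ toℕ j))

Vert : ∀ {r c} → CylVertex r c → CylVertex r c → Set
Vert {r} (i , j) (i' , j') = (toℕ j ≡ toℕ j') × (StepMod r 1 (toℕ i) (toℕ i') ⊎ StepMod r 1 (toℕ i') (toℕ i))

CylAdj : ∀ {r c} → CylVertex r c → CylVertex r c → Set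
CylAdj p q = Horiz p q ⊎ Vert p q

HamPathCyl : (r c h s₁ s₂ t₁ t₂ : ℕ) → Set
HamPathCyl r c h s₁ s₂ t₁ t₂ =
  Σ ℕ λ L → Σ (suc L ≡ r * c) λ _ →
  Σ (Fin (suc L) → CylVertex r c) λ π →
      Injective _≡_ _≡_ π
    × All (λ e → CylAdj (proj₁ e) (proj₂ e)) (pathEdges L π)
    × toℕ (proj₁ (π fzero)) ≡ s₁ × toℕ (proj₂ (π fzero)) ≡ s₂
    × toℕ (proj₁ (π (fromℕ L))) ≡ t₁ × toℕ (proj₂ (π (fromℕ L))) ≡ t₂
    × length (filter (λ e → horiz? (proj₁ e) (proj₂ e)) (pathEdges L π)) ≡ h

module Submission where

-- The map (i , j) ↦ i·a₁ + j·a₂ (mod n) identifies the r × g cylinder with ℤₙ: a₁-steps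
-- are the vertical edges, and a₂-steps are the horizontal edges together with the steps
-- that wrap around from column g − 1 to column 0; as x·a₁ + g·a₂ ≡ 0, the a₂-step from
-- (x , g − 1) leads to (0 , 0).  So a cylinder path from (0 , 0) to (x , g − 1) closes up
-- into a Hamiltonian cycle by one more a₂-edge.
-- Conversely, let c_t count the a₂-edges of a Hamiltonian cycle that leave column t, each
-- a₂-edge leaving exactly one column, so that Σ c_t = k.  The cycle crosses the boundary of
-- the band of columns (p , q] exactly c_p + c_q times, an even and nonzero number.  Since
-- k < 2(g − 1), all c_t are odd and some c_t is 1; cutting the cycle at that edge and
-- translating it to start at 0 gives a path that never wraps around, i.e. a cylinder path
-- from (0 , 0) to (x , g − 1) with k − 1 horizontal edges.

module Congruence where

  open import Data.Nat as ℕ using (ℕ; zero; suc; _∸_; NonZero)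
  import Data.Nat.Properties as ℕ
  open import Data.Nat.Divisibility as ℕ∣ using () renaming (_∣_ to _ℕ∣_)
  open import Data.Nat.GCD using (GCD; module Bézout)
  open import Data.Nat.DivMod using (_%_; _/_; m%n<n; m<n⇒m%n≡m; [m+kn]%n≡m%n; m≡m%n+[m/n]*n)
  open import Data.Integer using (ℤ; +_; -[1+_]; _+_; _*_; _-_; -_; 0ℤ)
  open import Data.Integer.Properties using (pos-+; pos-*; +-injective)
  open import Data.Integer.Divisibility.Signed
    using (_∣_; divides; ∣ᵤ⇒∣; ∣-trans; ∣m∣n⇒∣m+n; ∣m⇒∣-m; ∣n⇒∣m*n; *-cancelʳ-∣)
  open import Data.Integer.Tactic.RingSolver using (solve-∀)
  open import Data.Product using (∃; _,_)
  open import Data.Sum using (_⊎_; inj₁; inj₂)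
  open import Data.Empty using (⊥-elim)
  open import Relation.Binary.PropositionalEquality
  open import Relation.Binary.Bundles using (Setoid)
  import Relation.Binary.Reasoning.Setoid as SetoidReasoning
  open import Defs using (StepMod)

  infix 4 _≡_mod_

  -- A record, not a definition, so that a and b can be inferred from a ≡ b mod m.
  record _≡_mod_ (a b : ℤ) (m : ℕ) : Set where
    constructor mod-by
    field divides-difference : + m ∣ a - b

  module _ {m : ℕ} where

    ≡⇒≡-mod : ∀ {a b} → a ≡ b → a ≡ b mod m
    ≡⇒≡-mod {a} refl = mod-by (divides 0ℤ (a-a≡0 a (+ m)))
      where
      a-a≡0 : ∀ a m → a - a ≡ 0ℤ * m
      a-a≡0 = solve-∀

    mod-refl : ∀ {a} → a ≡ a mod m
    mod-refl = ≡⇒≡-mod refl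

    mod-sym : ∀ {a b} → a ≡ b mod m → b ≡ a mod m
    mod-sym {a} {b} (mod-by p) = mod-by (subst (+ m ∣_) (neg-diff a b) (∣m⇒∣-m p))
      where
      neg-diff : ∀ a b → - (a - b) ≡ b - a
      neg-diff = solve-∀

    mod-trans : ∀ {a b c} → a ≡ b mod m → b ≡ c mod m → a ≡ c mod m
    mod-trans {a} {b} {c} (mod-by p) (mod-by q) = mod-by (subst (+ m ∣_) (diff-+ a b c) (∣m∣n⇒∣m+n p q))
      where
      diff-+ : ∀ a b c → (a - b) + (b - c) ≡ a - c
      diff-+ = solve-∀

    +-cong-mod : ∀ {a b c d} → a ≡ b mod m → c ≡ d mod m → a + c ≡ b + d mod m
    +-cong-mod {a} {b} {c} {d} (mod-by p) (mod-by q) = mod-by (subst (+ m ∣_) (diff-+ a b c d) (∣m∣n⇒∣m+n p q))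
      where
      diff-+ : ∀ a b c d → (a - b) + (c - d) ≡ (a + c) - (b + d)
      diff-+ = solve-∀

    +-congˡ-mod : ∀ c {a b} → a ≡ b mod m → c + a ≡ c + b mod m
    +-congˡ-mod c p = +-cong-mod (mod-refl {c}) p

    +-congʳ-mod : ∀ c {a b} → a ≡ b mod m → a + c ≡ b + c mod m
    +-congʳ-mod c p = +-cong-mod p (mod-refl {c})

    *-congˡ-mod : ∀ c {a b} → a ≡ b mod m → c * a ≡ c * b mod m
    *-congˡ-mod c {a} {b} (mod-by p) = mod-by (subst (+ m ∣_) (diff-* c a b) (∣n⇒∣m*n c p))
      where
      diff-* : ∀ c a b → c * (a - b) ≡ c * a - c * b
      diff-* = solve-∀

    +-cancelˡ-mod : ∀ c {a b} → c + a ≡ c + b mod m → a ≡ b mod m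
    +-cancelˡ-mod c {a} {b} (mod-by p) = mod-by (subst (+ m ∣_) (diff-+ c a b) p)
      where
      diff-+ : ∀ c a b → (c + a) - (c + b) ≡ a - b
      diff-+ = solve-∀

    +-cancelʳ-mod : ∀ c {a b} → a + c ≡ b + c mod m → a ≡ b mod m
    +-cancelʳ-mod c {a} {b} (mod-by p) = mod-by (subst (+ m ∣_) (diff-+ c a b) p)
      where
      diff-+ : ∀ c a b → (a + c) - (b + c) ≡ a - b
      diff-+ = solve-∀

    multiple≡0-mod : ∀ k → k * + m ≡ 0ℤ mod m
    multiple≡0-mod k = mod-by (divides k (minus-0 (k * + m)))
      where
      minus-0 : ∀ x → x - 0ℤ ≡ x
      minus-0 = solve-∀

    modulus≡0-mod : + m ≡ 0ℤ mod m
    modulus≡0-mod = mod-trans (≡⇒≡-mod (one-times (+ m))) (multiple≡0-mod (+ 1))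
      where
      one-times : ∀ x → x ≡ + 1 * x
      one-times = solve-∀

  mod-setoid : ℕ → Setoid _ _
  mod-setoid m = record
    { Carrier = ℤ
    ; _≈_ = λ a b → a ≡ b mod m
    ; isEquivalence = record { refl = mod-refl ; sym = mod-sym ; trans = mod-trans }
    }

  module ≡-mod-Reasoning (m : ℕ) = SetoidReasoning (mod-setoid m)

  mod-divisor : ∀ {d m a b} → d ℕ∣ m → a ≡ b mod m → a ≡ b mod d
  mod-divisor d∣m (mod-by p) = mod-by (∣-trans (∣ᵤ⇒∣ d∣m) p)

  *-cancelʳ-mod : ∀ {r g a b} .{{_ : NonZero g}} →
                  a * + g ≡ b * + g mod r ℕ.* g → a ≡ b mod r
  *-cancelʳ-mod {r} {g} {a} {b} (mod-by p) =
    mod-by (*-cancelʳ-∣ (+ g) (subst₂ _∣_ (pos-* r g) (diff-* a b (+ g)) p))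
    where
    diff-* : ∀ a b g → a * g - b * g ≡ (a - b) * g
    diff-* = solve-∀

  ≡+multiple⇒≡ : ∀ {a b m} → a ℕ.< m → b ℕ.< m → ∀ k → a ≡ b ℕ.+ k ℕ.* m → a ≡ b
  ≡+multiple⇒≡ {a} {b} {m} a<m b<m k eq = begin
    a                   ≡⟨ m<n⇒m%n≡m a<m ⟨
    a % m               ≡⟨ cong (_% m) eq ⟩
    (b ℕ.+ k ℕ.* m) % m ≡⟨ [m+kn]%n≡m%n b k m ⟩
    b % m               ≡⟨ m<n⇒m%n≡m b<m ⟩
    b                   ∎
    where
    open ≡-Reasoning
    instance
      m≢0 : NonZero m
      m≢0 = ℕ.>-nonZero (ℕ.<-≤-trans ℕ.z<s b<m)

  module _ {m : ℕ} where

    mod⇒ℕ : ∀ a b → + a ≡ + b mod m →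
            ∃ λ k → a ≡ b ℕ.+ k ℕ.* m ⊎ b ≡ a ℕ.+ k ℕ.* m
    mod⇒ℕ a b (mod-by (divides (+ k) eq)) = k , inj₁ (+-injective (begin
      + a                  ≡⟨ solve-a (+ a) (+ b) ⟩
      + b + (+ a - + b)    ≡⟨ cong (λ z → + b + z) eq ⟩
      + b + + k * + m      ≡⟨ cong (λ z → + b + z) (pos-* k m) ⟨
      + b + + (k ℕ.* m)    ≡⟨ pos-+ b (k ℕ.* m) ⟨
      + (b ℕ.+ k ℕ.* m)    ∎))
      where
      open ≡-Reasoning
      solve-a : ∀ a b → a ≡ b + (a - b)
      solve-a = solve-∀
    mod⇒ℕ a b (mod-by (divides -[1+ k ] eq)) = suc k , inj₂ (+-injective (begin
      + b                          ≡⟨ solve-b (+ a) (+ b) ⟩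
      + a - (+ a - + b)            ≡⟨ cong (λ z → + a - z) eq ⟩
      + a - -[1+ k ] * + m         ≡⟨ solve-neg (+ a) (+ suc k) (+ m) ⟩
      + a + + suc k * + m          ≡⟨ cong (λ z → + a + z) (pos-* (suc k) m) ⟨
      + a + + (suc k ℕ.* m)        ≡⟨ pos-+ a (suc k ℕ.* m) ⟨
      + (a ℕ.+ suc k ℕ.* m)        ∎))
      where
      open ≡-Reasoning
      solve-b : ∀ a b → b ≡ a - (a - b)
      solve-b = solve-∀
      solve-neg : ∀ a k m → a - (- k) * m ≡ a + k * m
      solve-neg = solve-∀

    ℕ⇒mod : ∀ a b k → a ≡ b ℕ.+ k ℕ.* m → + a ≡ + b mod m
    ℕ⇒mod a b k eq = mod-by (divides (+ k) (begin
      + a - + b                  ≡⟨ cong (λ z → + z - + b) eq ⟩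
      + (b ℕ.+ k ℕ.* m) - + b    ≡⟨ cong (_- + b) (pos-+ b (k ℕ.* m)) ⟩
      + b + + (k ℕ.* m) - + b    ≡⟨ solve-k (+ b) (+ (k ℕ.* m)) ⟩
      + (k ℕ.* m)                ≡⟨ pos-* k m ⟩
      + k * + m                  ∎))
      where
      open ≡-Reasoning
      solve-k : ∀ b x → b + x - b ≡ x
      solve-k = solve-∀

    mod-injective-< : ∀ {a b} → a ℕ.< m → b ℕ.< m → + a ≡ + b mod m → a ≡ b
    mod-injective-< {a} {b} a<m b<m p with mod⇒ℕ a b p
    ... | k , inj₁ eq = ≡+multiple⇒≡ a<m b<m k eq
    ... | k , inj₂ eq = sym (≡+multiple⇒≡ b<m a<m k eq)

  ∣⇒≡0-mod : ∀ {m v} → m ℕ∣ v → + v ≡ 0ℤ mod m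
  ∣⇒≡0-mod {m} {v} (ℕ∣.divides q eq) = ℕ⇒mod v 0 q eq

  %≡-mod : ∀ m .{{_ : NonZero m}} v → + (v % m) ≡ + v mod m
  %≡-mod m v = mod-sym (ℕ⇒mod v (v % m) (v / m) (m≡m%n+[m/n]*n v m))

  StepMod⇒mod : ∀ {m} d u w → StepMod m d u w → + u + + d ≡ + w mod m
  StepMod⇒mod {m} d u w step = subst (_≡ + w mod m) (pos-+ u d) (ℕ-form step)
    where
    ℕ-form : StepMod m d u w → + (u ℕ.+ d) ≡ + w mod m
    ℕ-form (inj₁ eq) = ≡⇒≡-mod (cong +_ eq)
    ℕ-form (inj₂ eq) = ℕ⇒mod (u ℕ.+ d) w 1 (trans eq (cong (w ℕ.+_) (sym (ℕ.*-identityˡ m))))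

  mod⇒StepMod : ∀ {m d u w} → u ℕ.< m → w ℕ.< m → d ℕ.≤ m →
                + u + + d ≡ + w mod m → StepMod m d u w
  mod⇒StepMod {m} {d} {u} {w} u<m w<m d≤m p
    with mod⇒ℕ (u ℕ.+ d) w (subst (_≡ + w mod m) (sym (pos-+ u d)) p)
  ... | zero , inj₁ eq = inj₁ (trans eq (ℕ.+-identityʳ w))
  ... | suc zero , inj₁ eq = inj₂ (trans eq (cong (w ℕ.+_) (ℕ.+-identityʳ m)))
  ... | suc (suc k) , inj₁ eq = ⊥-elim (ℕ.<-irrefl eq (begin-strict
    u ℕ.+ d                       <⟨ ℕ.+-mono-<-≤ u<m d≤m ⟩
    m ℕ.+ m                       ≤⟨ ℕ.m≤n+m (m ℕ.+ m) w ⟩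
    w ℕ.+ (m ℕ.+ m)               ≤⟨ ℕ.+-monoʳ-≤ w (ℕ.+-monoʳ-≤ m (ℕ.m≤m+n m (k ℕ.* m))) ⟩
    w ℕ.+ suc (suc k) ℕ.* m       ∎))
    where open ℕ.≤-Reasoning
  ... | zero , inj₂ eq = inj₁ (sym (trans eq (ℕ.+-identityʳ (u ℕ.+ d))))
  ... | suc k , inj₂ eq = ⊥-elim (ℕ.<-irrefl eq (begin-strict
    w                             <⟨ w<m ⟩
    m                             ≤⟨ ℕ.m≤m+n m (k ℕ.* m) ⟩
    suc k ℕ.* m                   ≤⟨ ℕ.m≤n+m (suc k ℕ.* m) (u ℕ.+ d) ⟩
    u ℕ.+ d ℕ.+ suc k ℕ.* m       ∎))
    where open ℕ.≤-Reasoning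

  gcd-as-multiple : ∀ {m a d} → GCD m a d → ∃ λ U → U * + a ≡ + d mod m
  gcd-as-multiple {m} {a} {d} gcd with Bézout.identity gcd
  ... | Bézout.+- u v eq = - + v , mod-by (divides (- + u) (begin
    (- + v) * + a - + d            ≡⟨ solve-neg (+ d) (+ v) (+ a) ⟩
    - (+ d + + v * + a)            ≡⟨ cong -_ (lift-+* d v a) ⟩
    - + (d ℕ.+ v ℕ.* a)            ≡⟨ cong (λ z → - + z) eq ⟩
    - + (u ℕ.* m)                  ≡⟨ cong -_ (pos-* u m) ⟩
    - (+ u * + m)                  ≡⟨ solve-neg* (+ u) (+ m) ⟩
    (- + u) * + m                  ∎))
    where
    open ≡-Reasoning
    solve-neg : ∀ d v a → (- v) * a - d ≡ - (d + v * a)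
    solve-neg = solve-∀
    solve-neg* : ∀ u m → - (u * m) ≡ (- u) * m
    solve-neg* = solve-∀
    lift-+* : ∀ d v a → + d + + v * + a ≡ + (d ℕ.+ v ℕ.* a)
    lift-+* d v a = trans (cong (λ z → + d + z) (sym (pos-* v a))) (sym (pos-+ d (v ℕ.* a)))
  ... | Bézout.-+ u v eq = + v , mod-by (divides (+ u) (begin
    + v * + a - + d                ≡⟨ cong (_- + d) (sym (pos-* v a)) ⟩
    + (v ℕ.* a) - + d              ≡⟨ cong (λ z → + z - + d) (sym eq) ⟩
    + (d ℕ.+ u ℕ.* m) - + d        ≡⟨ cong (_- + d) (pos-+ d (u ℕ.* m)) ⟩
    + d + + (u ℕ.* m) - + d        ≡⟨ solve-cancel (+ d) (+ (u ℕ.* m)) ⟩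
    + (u ℕ.* m)                    ≡⟨ pos-* u m ⟩
    + u * + m                      ∎))
    where
    open ≡-Reasoning
    solve-cancel : ∀ d x → d + x - d ≡ x
    solve-cancel = solve-∀

  ≡0-mod⇒≡modulus : ∀ {m v} → 0 ℕ.< v → v ℕ.≤ m → + v ≡ 0ℤ mod m → v ≡ m
  ≡0-mod⇒≡modulus {m} {v} 0<v v≤m p with mod⇒ℕ v 0 p
  ... | zero , inj₁ v≡0 = ⊥-elim (ℕ.<-irrefl (sym v≡0) 0<v)
  ... | suc zero , inj₁ v≡m = trans v≡m (ℕ.+-identityʳ m)
  ... | suc (suc k) , inj₁ v≡[2+k]m = ⊥-elim (ℕ.<-irrefl v≡[2+k]m (begin-strict
    v                        ≤⟨ v≤m ⟩
    m                        <⟨ ℕ.m<m+n m (ℕ.<-≤-trans 0<v (ℕ.≤-trans v≤m (ℕ.m≤m+n m (k ℕ.* m)))) ⟩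
    suc (suc k) ℕ.* m        ∎))
    where open ℕ.≤-Reasoning
  ... | k , inj₂ 0≡v+km = ⊥-elim (ℕ.<-irrefl 0≡v+km (ℕ.<-≤-trans 0<v (ℕ.m≤m+n v (k ℕ.* m))))

  *-rescale-mod : ∀ {m a u} w c c′ → w * a ≡ u mod m → c * a ≡ c′ * a mod m → c * u ≡ c′ * u mod m
  *-rescale-mod {m} {a} {u} w c c′ wa≡u ca≡c′a = begin
    c * u          ≈⟨ *-congˡ-mod c wa≡u ⟨
    c * (w * a)    ≡⟨ swap c w a ⟩
    w * (c * a)    ≈⟨ *-congˡ-mod w ca≡c′a ⟩
    w * (c′ * a)   ≡⟨ swap c′ w a ⟨
    c′ * (w * a)   ≈⟨ *-congˡ-mod c′ wa≡u ⟩
    c′ * u         ∎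
    where
    open ≡-mod-Reasoning m
    swap : ∀ c w a → c * (w * a) ≡ w * (c * a)
    swap = solve-∀

  round-trip-mod : ∀ {m w} u a b → u + a ≡ w mod m → w + b ≡ u mod m → a + b ≡ 0ℤ mod m
  round-trip-mod {m} {w} u a b there back = +-cancelˡ-mod u (begin
    u + (a + b)    ≡⟨ assoc u a b ⟩
    u + a + b      ≈⟨ +-cong-mod there mod-refl ⟩
    w + b          ≈⟨ back ⟩
    u              ≡⟨ plus-0 u ⟩
    u + 0ℤ         ∎)
    where
    open ≡-mod-Reasoning m
    assoc : ∀ u a b → u + (a + b) ≡ u + a + b
    assoc = solve-∀
    plus-0 : ∀ u → u ≡ u + 0ℤ
    plus-0 = solve-∀

  module _ (m : ℕ) .{{_ : NonZero m}} where

    mod⇒%≡ : ∀ a b → + a ≡ + b mod m → a % m ≡ b % m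
    mod⇒%≡ a b a≡b = mod-injective-< (m%n<n a m) (m%n<n b m)
      (mod-trans (%≡-mod m a) (mod-trans a≡b (mod-sym (%≡-mod m b))))

    %≡⇒mod : ∀ a b → a % m ≡ b % m → + a ≡ + b mod m
    %≡⇒mod a b eq = mod-trans (mod-sym (%≡-mod m a)) (mod-trans (≡⇒≡-mod (cong +_ eq)) (%≡-mod m b))

  ∸-cancel-mod : ∀ {m N p p′} → p ℕ.≤ N → p′ ℕ.≤ N → + (N ∸ p) ≡ + (N ∸ p′) mod m → + p ≡ + p′ mod m
  ∸-cancel-mod {m} {N} {p} {p′} p≤N p′≤N eq = mod-sym (+-cancelˡ-mod (+ N) (begin
    + N + + p′                  ≡⟨ cong (_+ + p′) (complement p≤N) ⟨
    + (N ∸ p) + + p + + p′      ≡⟨ assoc (+ (N ∸ p)) (+ p) (+ p′) ⟩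
    + (N ∸ p) + (+ p + + p′)    ≈⟨ +-congʳ-mod (+ p + + p′) eq ⟩
    + (N ∸ p′) + (+ p + + p′)   ≡⟨ shuffle (+ (N ∸ p′)) (+ p) (+ p′) ⟩
    + (N ∸ p′) + + p′ + + p     ≡⟨ cong (_+ + p) (complement p′≤N) ⟩
    + N + + p                   ∎))
    where
    open ≡-mod-Reasoning m
    complement : ∀ {q} → q ℕ.≤ N → + (N ∸ q) + + q ≡ + N
    complement {q} q≤N = trans (sym (pos-+ (N ∸ q) q)) (cong +_ (ℕ.m∸n+n≡m q≤N))
    assoc : ∀ a b c → a + b + c ≡ a + (b + c)
    assoc = solve-∀
    shuffle : ∀ a b c → a + (b + c) ≡ a + c + b
    shuffle = solve-∀

module FiniteSum where

  open import Data.Nat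
  open import Data.Nat.Properties
  open import Data.Bool using (Bool; true; false; _∧_)
  open import Data.Product using (∃; _,_; _×_)
  open import Data.Empty using (⊥-elim)
  open import Relation.Nullary using (does)
  open import Relation.Binary.PropositionalEquality
  open import Data.Nat.Tactic.RingSolver using (solve-∀)

  𝟙 : Bool → ℕ
  𝟙 true = 1
  𝟙 false = 0

  𝟙-∧ : ∀ b b′ → 𝟙 (b ∧ b′) ≡ 𝟙 b * 𝟙 b′
  𝟙-∧ true b′ = sym (+-identityʳ (𝟙 b′))
  𝟙-∧ false b′ = refl

  ∑ : ℕ → (ℕ → ℕ) → ℕ
  ∑ zero f = 0
  ∑ (suc L) f = f 0 + ∑ L (λ m → f (suc m))

  infix 7 ∑
  syntax ∑ L (λ m → e) = ∑[ m < L ] e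

  ∑-cong : ∀ L {f h : ℕ → ℕ} → (∀ m → m < L → f m ≡ h m) → ∑ L f ≡ ∑ L h
  ∑-cong zero eq = refl
  ∑-cong (suc L) eq = cong₂ _+_ (eq 0 z<s) (∑-cong L (λ m m<L → eq (suc m) (s<s m<L)))

  ∑-snoc : ∀ L f → ∑ (suc L) f ≡ ∑ L f + f L
  ∑-snoc zero f = +-comm (f 0) 0
  ∑-snoc (suc L) f = trans (cong (f 0 +_) (∑-snoc L (λ m → f (suc m)))) (sym (+-assoc (f 0) _ _))

  ∑-+ : ∀ L f h → ∑[ m < L ] (f m + h m) ≡ ∑ L f + ∑ L h
  ∑-+ zero f h = refl
  ∑-+ (suc L) f h = trans (cong (f 0 + h 0 +_) (∑-+ L (λ m → f (suc m)) (λ m → h (suc m))))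
                          (interchange (f 0) (h 0) _ _)
    where
    interchange : ∀ a b c d → (a + b) + (c + d) ≡ (a + c) + (b + d)
    interchange = solve-∀

  ∑-*ˡ : ∀ L c f → ∑[ m < L ] (c * f m) ≡ c * ∑ L f
  ∑-*ˡ zero c f = sym (*-zeroʳ c)
  ∑-*ˡ (suc L) c f = trans (cong (c * f 0 +_) (∑-*ˡ L c (λ m → f (suc m)))) (sym (*-distribˡ-+ c (f 0) _))

  ∑-zero : ∀ L → ∑[ _ < L ] 0 ≡ 0
  ∑-zero zero = refl
  ∑-zero (suc L) = ∑-zero L

  ∑-swap : ∀ K L (F : ℕ → ℕ → ℕ) → ∑[ t < K ] ∑ L (F t) ≡ ∑[ m < L ] ∑[ t < K ] F t m
  ∑-swap zero L F = sym (∑-zero L)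
  ∑-swap (suc K) L F = trans (cong (∑ L (F 0) +_) (∑-swap K L (λ t → F (suc t))))
                             (sym (∑-+ L (F 0) (λ m → ∑[ t < K ] F (suc t) m)))

  ∑-mono : ∀ L a f → (∀ m → m < L → a ≤ f m) → L * a ≤ ∑ L f
  ∑-mono zero a f le = z≤n
  ∑-mono (suc L) a f le = +-mono-≤ (le 0 z<s) (∑-mono L a (λ m → f (suc m)) (λ m m<L → le (suc m) (s<s m<L)))

  ∑≡0⇒≡0 : ∀ L f → ∑ L f ≡ 0 → ∀ m → m < L → f m ≡ 0
  ∑≡0⇒≡0 (suc L) f eq zero _ = m+n≡0⇒m≡0 (f 0) eq
  ∑≡0⇒≡0 (suc L) f eq (suc m) (s<s m<L) = ∑≡0⇒≡0 L (λ m → f (suc m)) (m+n≡0⇒n≡0 (f 0) eq) m m<L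

  ∑𝟙≡1⇒unique : ∀ L (b : ℕ → Bool) → ∑[ m < L ] 𝟙 (b m) ≡ 1 →
                 ∃ λ m → m < L × b m ≡ true × (∀ m′ → m′ < L → b m′ ≡ true → m′ ≡ m)
  ∑𝟙≡1⇒unique (suc L) b eq with b 0 in b0
  ... | true = 0 , z<s , b0 , only-0
    where
    only-0 : ∀ m′ → m′ < suc L → b m′ ≡ true → m′ ≡ 0
    only-0 zero _ _ = refl
    only-0 (suc m′) (s<s m′<L) bm′
      with ∑≡0⇒≡0 L (λ m → 𝟙 (b (suc m))) (suc-injective eq) m′ m′<L
    ... | ≡0 rewrite bm′ = ⊥-elim (1+n≢0 ≡0)
  ... | false with ∑𝟙≡1⇒unique L (λ m → b (suc m)) eq
  ...   | m , m<L , bm , unique = suc m , s<s m<L , bm , only-suc-m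
    where
    only-suc-m : ∀ m′ → m′ < suc L → b m′ ≡ true → m′ ≡ suc m
    only-suc-m zero _ b0′ with () ← trans (sym b0) b0′
    only-suc-m (suc m′) (s<s m′<L) bm′ = cong suc (unique m′ m′<L bm′)

  ∑𝟙≟≡1 : ∀ K y → y < K → ∑[ t < K ] 𝟙 (does (y ≟ t)) ≡ 1
  ∑𝟙≟≡1 (suc K) zero _ = cong suc (none K)
    where
    none : ∀ K → ∑[ t < K ] 𝟙 (does (0 ≟ suc t)) ≡ 0
    none zero = refl
    none (suc K) = none K
  ∑𝟙≟≡1 (suc K) (suc y) (s<s y<K) = ∑𝟙≟≡1 K y y<K

  ∑-rotate : ∀ L f → (∀ m → f (m + L) ≡ f m) → ∀ c → ∑[ p < L ] f (p + c) ≡ ∑ L f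
  ∑-rotate L f periodic zero = ∑-cong L (λ p _ → cong f (+-identityʳ p))
  ∑-rotate L f periodic (suc c) = begin
    ∑[ p < L ] f (p + suc c)    ≡⟨ ∑-cong L (λ p _ → cong f (+-suc p c)) ⟩
    ∑[ p < L ] f (suc p + c)    ≡⟨ rotate-once L (λ p → f (p + c)) (trans (cong f (+-comm L c)) (periodic c)) ⟩
    ∑[ p < L ] f (p + c)        ≡⟨ ∑-rotate L f periodic c ⟩
    ∑ L f                       ∎
    where
    open ≡-Reasoning
    rotate-once : ∀ L h → h L ≡ h 0 → ∑[ p < L ] h (suc p) ≡ ∑ L h
    rotate-once zero h eq = refl
    rotate-once (suc L) h eq = begin
      ∑[ p < suc L ] h (suc p)         ≡⟨ ∑-snoc L (λ p → h (suc p)) ⟩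
      ∑[ p < L ] h (suc p) + h (suc L) ≡⟨ cong (∑[ p < L ] h (suc p) +_) eq ⟩
      ∑[ p < L ] h (suc p) + h 0       ≡⟨ +-comm _ (h 0) ⟩
      ∑ (suc L) h                      ∎

  ∑-reverse : ∀ L (f : ℕ → ℕ) → ∑[ p < L ] f (L ∸ p) ≡ ∑[ p < L ] f (suc p)
  ∑-reverse zero f = refl
  ∑-reverse (suc L) f = begin
    f (suc L) + ∑[ p < L ] f (L ∸ p)     ≡⟨ cong (f (suc L) +_) (∑-reverse L f) ⟩
    f (suc L) + ∑[ p < L ] f (suc p)     ≡⟨ +-comm (f (suc L)) _ ⟩
    ∑[ p < L ] f (suc p) + f (suc L)     ≡⟨ ∑-snoc L (λ p → f (suc p)) ⟨
    ∑[ p < suc L ] f (suc p)             ∎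
    where open ≡-Reasoning

module FinCounting where

  open import Data.Nat using (ℕ; zero; suc; _+_)
  open import Data.Nat.Properties using (1+n≰n)
  open import Data.Bool using (true; false)
  open import Data.Fin using (Fin; toℕ; punchOut) renaming (zero to fzero; suc to fsuc)
  open import Data.Fin.Properties using (any?; punchOut-injective; injective⇒≤) renaming (_≟_ to _≟ᶠ_)
  open import Data.List using (List; []; _∷_; _++_; map; length; filter; tabulate; allFin)
  open import Data.List.Properties using (map-tabulate; filter-++; length-++)
  open import Data.Product using (∃; _,_)
  open import Data.Empty using (⊥-elim)
  open import Relation.Nullary using (yes; no; does)
  open import Relation.Unary using (Pred; Decidable)
  open import Relation.Binary.PropositionalEquality
  open import Function.Base using (_∘_)
  open import Function.Definitions using (Injective)
  open FiniteSum

  module _ {a p} {A : Set a} {P : Pred A p} (P? : Decidable P) where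

    length-filter-[x] : ∀ x → length (filter P? (x ∷ [])) ≡ 𝟙 (does (P? x))
    length-filter-[x] x with does (P? x)
    ... | true = refl
    ... | false = refl

    length-filter-snoc : ∀ (xs : List A) y → length (filter P? (xs ++ y ∷ [])) ≡ length (filter P? xs) + 𝟙 (does (P? y))
    length-filter-snoc xs y = begin
      length (filter P? (xs ++ y ∷ []))                ≡⟨ cong length (filter-++ P? xs (y ∷ [])) ⟩
      length (filter P? xs ++ filter P? (y ∷ []))      ≡⟨ length-++ (filter P? xs) ⟩
      length (filter P? xs) + length (filter P? (y ∷ [])) ≡⟨ cong (length (filter P? xs) +_) (length-filter-[x] y) ⟩
      length (filter P? xs) + 𝟙 (does (P? y))          ∎
      where open ≡-Reasoning

    length-filter-tabulate : ∀ L (G : Fin L → A) (h : ℕ → ℕ) → (∀ i → 𝟙 (does (P? (G i))) ≡ h (toℕ i)) →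
                             length (filter P? (tabulate G)) ≡ ∑ L h
    length-filter-tabulate zero G h eq = refl
    length-filter-tabulate (suc L) G h eq with does (P? (G fzero)) | eq fzero
    ... | true  | eq₀ = cong₂ _+_ eq₀ (length-filter-tabulate L (G ∘ fsuc) (h ∘ suc) (eq ∘ fsuc))
    ... | false | eq₀ = cong₂ _+_ eq₀ (length-filter-tabulate L (G ∘ fsuc) (h ∘ suc) (eq ∘ fsuc))

    length-filter-map-allFin : ∀ L (G : Fin L → A) (h : ℕ → ℕ) → (∀ i → 𝟙 (does (P? (G i))) ≡ h (toℕ i)) →
                               length (filter P? (map G (allFin L))) ≡ ∑ L h
    length-filter-map-allFin L G h eq =
      trans (cong (λ xs → length (filter P? xs)) (map-tabulate (λ i → i) G)) (length-filter-tabulate L G h eq)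

  length-filter-cong : ∀ {a b p q} {A : Set a} {B : Set b} {P : Pred A p} {Q : Pred B q}
                       (P? : Decidable P) (Q? : Decidable Q) L (F : Fin L → A) (G : Fin L → B) →
                       (∀ i → does (P? (F i)) ≡ does (Q? (G i))) →
                       length (filter P? (map F (allFin L))) ≡ length (filter Q? (map G (allFin L)))
  length-filter-cong P? Q? L F G same = begin
    length (filter P? (map F (allFin L)))    ≡⟨ cong (λ xs → length (filter P? xs)) (map-tabulate (λ i → i) F) ⟩
    length (filter P? (tabulate F))          ≡⟨ tabulated L F G same ⟩
    length (filter Q? (tabulate G))          ≡⟨ cong (λ xs → length (filter Q? xs)) (map-tabulate (λ i → i) G) ⟨
    length (filter Q? (map G (allFin L)))    ∎
    where
    open ≡-Reasoning
    tabulated : ∀ K (F′ : Fin K → _) (G′ : Fin K → _) → (∀ i → does (P? (F′ i)) ≡ does (Q? (G′ i))) →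
                length (filter P? (tabulate F′)) ≡ length (filter Q? (tabulate G′))
    tabulated zero F′ G′ agree = refl
    tabulated (suc K) F′ G′ agree with does (P? (F′ fzero)) | does (Q? (G′ fzero)) | agree fzero
    ... | true | true | _ = cong suc (tabulated K (λ i → F′ (fsuc i)) (λ i → G′ (fsuc i)) (λ i → agree (fsuc i)))
    ... | false | false | _ = tabulated K (λ i → F′ (fsuc i)) (λ i → G′ (fsuc i)) (λ i → agree (fsuc i))

  injective⇒surjective : ∀ {m n} (f : Fin m → Fin n) → Injective _≡_ _≡_ f → m ≡ n → ∀ y → ∃ λ x → f x ≡ y
  injective⇒surjective {suc m} f inj refl y with any? (λ x → f x ≟ᶠ y)
  ... | yes found = found
  ... | no missing = ⊥-elim (1+n≰n (injective⇒≤ {f = avoid} avoid-injective))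
    where
    y≢f : ∀ x → y ≢ f x
    y≢f x eq = missing (x , sym eq)
    avoid : Fin (suc m) → Fin m
    avoid x = punchOut (y≢f x)
    avoid-injective : Injective _≡_ _≡_ avoid
    avoid-injective eq = inj (punchOut-injective (y≢f _) (y≢f _) eq)

module Crossings where

  open import Data.Nat
  open import Data.Nat.Properties
  open import Data.Nat.Divisibility using (_∣_; _∤_; _∣?_; ∣m+n∣m⇒∣n; ∣m⇒∣m*n; ∣m∣n⇒∣m+n; _∣0; ∣-refl; ∣⇒≤)
  open import Data.Bool using (Bool; true; false; _xor_; _∧_)
  open import Data.Bool.Properties using (xor-same)
  open import Data.Fin as Fin using (toℕ; fromℕ<)
  open import Data.Fin.Properties using (any?; toℕ-fromℕ<; toℕ<n)
  open import Data.Product using (∃; _,_; _×_)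
  open import Data.Sum using (inj₁; inj₂)
  open import Data.Empty using (⊥; ⊥-elim)
  open import Relation.Nullary using (Dec; yes; no; does)
  open import Relation.Nullary.Decidable using (dec-true; dec-false)
  open import Relation.Binary using (tri<; tri≈; tri>)
  open import Relation.Binary.PropositionalEquality
  open import Data.Nat.Tactic.RingSolver using (solve-∀)
  open import Defs using (StepMod)
  open FiniteSum

  changes : (ℕ → Bool) → ℕ → ℕ
  changes b N = ∑[ m < N ] 𝟙 (b m xor b (suc m))

  xor-triangle : ∀ x y z → 2 ∣ 𝟙 (x xor y) + 𝟙 (y xor z) + 𝟙 (x xor z)
  xor-triangle true  true  true  = 2 ∣0
  xor-triangle true  true  false = ∣-refl
  xor-triangle true  false true  = ∣-refl
  xor-triangle true  false false = ∣-refl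
  xor-triangle false true  true  = ∣-refl
  xor-triangle false true  false = ∣-refl
  xor-triangle false false true  = ∣-refl
  xor-triangle false false false = 2 ∣0

  changes-parity : ∀ b N → 2 ∣ changes b N + 𝟙 (b 0 xor b N)
  changes-parity b zero rewrite xor-same (b 0) = 2 ∣0
  changes-parity b (suc N) = ∣m+n∣m⇒∣n (subst (2 ∣_) regroup both) (∣m⇒∣m*n x ∣-refl)
    where
    S x y z : ℕ
    S = changes b N
    x = 𝟙 (b 0 xor b N)
    y = 𝟙 (b N xor b (suc N))
    z = 𝟙 (b 0 xor b (suc N))
    both : 2 ∣ (S + x) + (x + y + z)
    both = ∣m∣n⇒∣m+n (changes-parity b N) (xor-triangle (b 0) (b N) (b (suc N)))
    regroup : (S + x) + (x + y + z) ≡ 2 * x + (changes b (suc N) + z)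
    regroup = trans (shuffle S x y z) (cong (λ s → 2 * x + (s + z)) (sym (∑-snoc N _)))
      where
      shuffle : ∀ S x y z → (S + x) + (x + y + z) ≡ 2 * x + ((S + y) + z)
      shuffle = solve-∀

  changes-even : ∀ b N → b N ≡ b 0 → 2 ∣ changes b N
  changes-even b N bN≡b0 = subst (2 ∣_) drop-last (changes-parity b N)
    where
    drop-last : changes b N + 𝟙 (b 0 xor b N) ≡ changes b N
    drop-last = trans (cong (λ v → changes b N + 𝟙 (b 0 xor v)) bN≡b0)
                      (trans (cong (λ v → changes b N + 𝟙 v) (xor-same (b 0))) (+-identityʳ _))

  changes≡0⇒constant : ∀ b N → changes b N ≡ 0 → ∀ m → m ≤ N → b m ≡ b 0
  changes≡0⇒constant b N none zero _ = refl
  changes≡0⇒constant b N none (suc m) m<N =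
    trans (sym (no-change (b m) (b (suc m)) (∑≡0⇒≡0 N _ none m m<N)))
          (changes≡0⇒constant b N none m (<⇒≤ m<N))
    where
    no-change : ∀ p q → 𝟙 (p xor q) ≡ 0 → p ≡ q
    no-change false false _ = refl
    no-change true true _ = refl

  private
    even≢0⇒≥2 : ∀ {x} → 2 ∣ x → x ≢ 0 → 2 ≤ x
    even≢0⇒≥2 {zero} _ x≢0 = ⊥-elim (x≢0 refl)
    even≢0⇒≥2 {suc x} 2∣x _ = ∣⇒≤ 2∣x

    odd⇒≥1 : ∀ {x} → 2 ∤ x → 1 ≤ x
    odd⇒≥1 {zero} 2∤x = ⊥-elim (2∤x (2 ∣0))
    odd⇒≥1 {suc x} _ = s≤s z≤n

    odd≢1⇒≥3 : ∀ {x} → 2 ∤ x → x ≢ 1 → 3 ≤ x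
    odd≢1⇒≥3 {0} 2∤x _ = ⊥-elim (2∤x (2 ∣0))
    odd≢1⇒≥3 {1} _ x≢1 = ⊥-elim (x≢1 refl)
    odd≢1⇒≥3 {2} 2∤x _ = ⊥-elim (2∤x ∣-refl)
    odd≢1⇒≥3 {suc (suc (suc x))} _ _ = s≤s (s≤s (s≤s z≤n))

    all-even⇒∑≥2[G-1] : ∀ G (c : ℕ → ℕ) → (∀ t → t < G → 2 ∣ c t) →
                         (∀ p q → p < q → q < G → c p ≡ 0 → c q ≡ 0 → ⊥) →
                         2 * (G ∸ 1) ≤ ∑ G c
    all-even⇒∑≥2[G-1] zero c even zeros = z≤n
    all-even⇒∑≥2[G-1] (suc G) c even zeros with c 0 ≟ 0
    ... | yes c0≡0 = begin
      2 * G                    ≡⟨ *-comm 2 G ⟩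
      G * 2                    ≤⟨ ∑-mono G 2 (λ m → c (suc m)) others≥2 ⟩
      ∑[ m < G ] c (suc m)     ≤⟨ m≤n+m _ (c 0) ⟩
      ∑ (suc G) c              ∎
      where
      open ≤-Reasoning
      others≥2 : ∀ m → m < G → 2 ≤ c (suc m)
      others≥2 m m<G = even≢0⇒≥2 (even (suc m) (s≤s m<G)) (zeros 0 (suc m) z<s (s≤s m<G) c0≡0)
    ... | no c0≢0 = begin
      2 * (suc G ∸ 1)              ≤⟨ two-more G ⟩
      2 + 2 * (G ∸ 1)              ≤⟨ +-mono-≤ (even≢0⇒≥2 (even 0 z<s) c0≢0) rest ⟩
      c 0 + ∑[ m < G ] c (suc m)   ∎
      where
      open ≤-Reasoning
      rest : 2 * (G ∸ 1) ≤ ∑[ m < G ] c (suc m)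
      rest = all-even⇒∑≥2[G-1] G (λ m → c (suc m)) (λ t t<G → even (suc t) (s≤s t<G))
               (λ p q p<q q<G → zeros (suc p) (suc q) (s≤s p<q) (s≤s q<G))
      two-more : ∀ G → 2 * G ≤ 2 + 2 * (G ∸ 1)
      two-more zero = z≤n
      two-more (suc G) = ≤-reflexive (*-suc 2 G)

  small-total⇒some≡1 : ∀ G (c : ℕ → ℕ) →
                       (∀ p q → p < q → q < G → 2 ∣ c p + c q) →
                       (∀ p q → p < q → q < G → c p ≡ 0 → c q ≡ 0 → ⊥) →
                       ∑ G c < 2 * (G ∸ 1) →
                       3 ≤ G × ∃ λ t → t < G × c t ≡ 1
  small-total⇒some≡1 G c even-pairs zeros small with 2 ∣? c 0
  ... | yes 2∣c0 = ⊥-elim (<⇒≱ small (all-even⇒∑≥2[G-1] G c all-even zeros))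
    where
    all-even : ∀ t → t < G → 2 ∣ c t
    all-even zero _ = 2∣c0
    all-even (suc t) t<G = ∣m+n∣m⇒∣n (even-pairs 0 (suc t) z<s t<G) 2∣c0
  ... | no 2∤c0 = three≤G , entry≡1 (any? (λ (t : Fin.Fin G) → c (toℕ t) ≟ 1))
    where
    all-odd : ∀ t → t < G → 2 ∤ c t
    all-odd zero _ = 2∤c0
    all-odd (suc t) t<G 2∣ct = 2∤c0 (∣m+n∣m⇒∣n (subst (2 ∣_) (+-comm (c 0) _) (even-pairs 0 (suc t) z<s t<G)) 2∣ct)
    three≤G : 3 ≤ G
    three≤G = G<2[G-1]⇒3≤G G (begin-strict
      G           ≡⟨ *-identityʳ G ⟨
      G * 1       ≤⟨ ∑-mono G 1 c (λ t t<G → odd⇒≥1 (all-odd t t<G)) ⟩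
      ∑ G c       <⟨ small ⟩
      2 * (G ∸ 1) ∎)
      where
      open ≤-Reasoning
      G<2[G-1]⇒3≤G : ∀ G → G < 2 * (G ∸ 1) → 3 ≤ G
      G<2[G-1]⇒3≤G (suc (suc (suc G))) _ = s≤s (s≤s (s≤s z≤n))
      G<2[G-1]⇒3≤G (suc (suc zero)) (s≤s (s≤s ()))
    entry≡1 : Dec (∃ λ (t : Fin.Fin G) → c (toℕ t) ≡ 1) → ∃ λ t → t < G × c t ≡ 1
    entry≡1 (yes (t , ct≡1)) = toℕ t , toℕ<n t , ct≡1
    entry≡1 (no none) = ⊥-elim (<⇒≱ small (begin
      2 * (G ∸ 1)  ≤⟨ *-monoʳ-≤ 2 (m∸n≤m G 1) ⟩
      2 * G        ≤⟨ *-monoˡ-≤ G (s≤s (s≤s (z≤n {1}))) ⟩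
      3 * G        ≡⟨ *-comm 3 G ⟩
      G * 3        ≤⟨ ∑-mono G 3 c (λ t t<G → odd≢1⇒≥3 (all-odd t t<G) (≢1 t t<G)) ⟩
      ∑ G c        ∎))
      where
      open ≤-Reasoning
      ≢1 : ∀ t → t < G → c t ≢ 1
      ≢1 t t<G ct≡1 = none (fromℕ< t<G , subst (λ v → c v ≡ 1) (sym (toℕ-fromℕ< t<G)) ct≡1)

  in-interval : ℕ → ℕ → ℕ → Bool
  in-interval p q c = does (p <? c) ∧ does (c ≤? q)

  in-interval-suc : ∀ p q c → p < q →
                    𝟙 (in-interval p q c xor in-interval p q (suc c)) ≡ 𝟙 (does (c ≟ p)) + 𝟙 (does (c ≟ q))
  in-interval-suc p q c p<q with <-cmp c p
  ... | tri< c<p c≢p _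
    rewrite dec-false (p <? c) (<-asym c<p) | dec-false (p <? suc c) (λ p<1+c → <-irrefl refl (<-≤-trans c<p (s≤s⁻¹ p<1+c)))
          | dec-false (c ≟ p) c≢p | dec-false (c ≟ q) (λ c≡q → <-irrefl c≡q (<-trans c<p p<q)) = refl
  ... | tri≈ _ refl _
    rewrite dec-false (c <? c) (<-irrefl refl) | dec-true (c <? suc c) (n<1+n c) | dec-true (suc c ≤? q) p<q
          | dec-true (c ≟ c) refl | dec-false (c ≟ q) (<⇒≢ p<q) = refl
  ... | tri> _ c≢p p<c
    rewrite dec-true (p <? c) p<c | dec-true (p <? suc c) (<-trans p<c (n<1+n c)) | dec-false (c ≟ p) c≢p
    with <-cmp c q
  ...   | tri< c<q c≢q _ rewrite dec-true (c ≤? q) (<⇒≤ c<q) | dec-true (suc c ≤? q) c<q | dec-false (c ≟ q) c≢q = refl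
  ...   | tri≈ _ refl _ rewrite dec-true (c ≤? c) ≤-refl | dec-false (suc c ≤? c) (<-irrefl refl) | dec-true (c ≟ c) refl = refl
  ...   | tri> _ c≢q q<c rewrite dec-false (c ≤? q) (<⇒≱ q<c) | dec-false (suc c ≤? q) (<-asym q<c) | dec-false (c ≟ q) c≢q = refl

  in-interval-step : ∀ G p q c c′ → p < q → q < G → c < G → StepMod G 1 c c′ →
                     𝟙 (in-interval p q c xor in-interval p q c′) ≡ 𝟙 (does (c ≟ p)) + 𝟙 (does (c ≟ q))
  in-interval-step G p q c c′ p<q q<G c<G (inj₁ c+1≡c′) rewrite sym (trans (+-comm 1 c) c+1≡c′) = in-interval-suc p q c p<q
  in-interval-step G p q c c′ p<q q<G c<G (inj₂ wrap) = wrap-to-0 c′≡0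
    where
    c′≡0 : c′ ≡ 0
    c′≡0 = n≤0⇒n≡0 (+-cancelʳ-≤ G c′ 0 (≤-trans (≤-reflexive (sym wrap)) (≤-trans (≤-reflexive (+-comm c 1)) c<G)))
    q≤c : q ≤ c
    q≤c = s≤s⁻¹ (≤-trans q<G (≤-reflexive (sym (trans (+-comm 1 c) (trans wrap (cong (_+ G) c′≡0))))))
    p<c : p < c
    p<c = <-≤-trans p<q q≤c
    wrap-to-0 : c′ ≡ 0 → 𝟙 (in-interval p q c xor in-interval p q c′) ≡ 𝟙 (does (c ≟ p)) + 𝟙 (does (c ≟ q))
    wrap-to-0 refl rewrite dec-true (p <? c) p<c | dec-false (c ≟ p) (≢-sym (<⇒≢ p<c)) with c ≤? q
    ... | yes c≤q rewrite dec-true (c ≤? q) c≤q | dec-true (c ≟ q) (≤-antisym c≤q q≤c) = refl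
    ... | no c≰q rewrite dec-false (c ≤? q) c≰q | dec-false (c ≟ q) (λ c≡q → c≰q (≤-reflexive c≡q)) = refl

open import Data.Nat as ℕ using (ℕ; suc; _≤_; _<_; _∸_; NonZero)
open import Data.Nat.GCD using (gcd; GCD)
open import Data.Nat.Divisibility using (_∣_)
open import Relation.Binary.PropositionalEquality

module TwoStripe (n a₁ a₂ : ℕ) (1≤a₁ : 1 ≤ a₁) (a₁≤n/2 : a₁ ≤ n ℕ./ 2) (1≤a₂ : 1 ≤ a₂) (a₂≤n/2 : a₂ ≤ n ℕ./ 2)
  (a₁≢a₂ : a₁ ≢ a₂) (g : ℕ) (g-gcd : GCD n a₁ g) (1<g : 1 < g) (g⊥a₂ : gcd g a₂ ≡ 1)
  (r : ℕ) (r*g≡n : r ℕ.* g ≡ n) (x : ℕ) (x<r : x < r) (n∣xa₁+ga₂ : n ∣ x ℕ.* a₁ ℕ.+ g ℕ.* a₂) where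

  import Data.Nat.Properties as ℕ
  open import Data.Nat.DivMod using (_%_; _/_; m/n*n≤m; m%n<n; m<n*o⇒m/o<n; m≡m%n+[m/n]*n; m<n⇒m%n≡m)
  open import Data.Nat.GCD using (gcd-GCD; module GCD)
  open import Data.Integer using (ℤ; +_; _+_; _*_; 0ℤ)
  import Data.Integer.Properties as ℤ
  open import Data.Integer.Tactic.RingSolver using (solve-∀)
  open import Data.Bool using (Bool; true; false; _∧_; _∨_; _xor_; if_then_else_)
  open import Data.Bool.Properties using (xor-same; xor-comm; ∨-comm)
  open import Data.Fin using (Fin; toℕ; fromℕ<; fromℕ; inject₁) renaming (zero to fzero; suc to fsuc)
  open import Data.Fin.Properties using (toℕ-fromℕ<; toℕ-injective; toℕ-inject₁; toℕ<n; toℕ-fromℕ; fromℕ<-cong)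
  open import Data.Product using (Σ; ∃; _,_; _×_; proj₁; proj₂)
  open import Data.Sum using (_⊎_; inj₁; inj₂; [_,_]′)
  open import Data.Empty using (⊥; ⊥-elim)
  open import Data.List using (length; filter; allFin; map; _∷_; [])
  open import Data.List.Relation.Unary.All using (All; []; _∷_)
  open import Data.List.Relation.Unary.All.Properties using (map⁺; map⁻; tabulate⁺; tabulate⁻; ++⁺; ++⁻)
  open import Relation.Nullary using (Dec; yes; no; does; ¬_)
  open import Relation.Nullary.Decidable using (_⊎-dec_; dec-true; dec-false)
  open import Relation.Unary using (Decidable)
  open import Function.Definitions using (Injective)
  open import Defs
  open Congruence
  open FiniteSum
  open FinCounting
  open Crossings

  n/2+n/2≤n : n / 2 ℕ.+ n / 2 ≤ n
  n/2+n/2≤n = begin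
    n / 2 ℕ.+ n / 2       ≡⟨ cong (n / 2 ℕ.+_) (ℕ.+-identityʳ (n / 2)) ⟨
    2 ℕ.* (n / 2)         ≡⟨ ℕ.*-comm 2 (n / 2) ⟩
    n / 2 ℕ.* 2           ≤⟨ m/n*n≤m n 2 ⟩
    n                     ∎
    where open ℕ.≤-Reasoning

  ≤n/2⇒2*≤n : ∀ {a} → a ≤ n / 2 → a ℕ.+ a ≤ n
  ≤n/2⇒2*≤n a≤n/2 = ℕ.≤-trans (ℕ.+-mono-≤ a≤n/2 a≤n/2) n/2+n/2≤n

  ≤n/2⇒<n : ∀ {a} → 1 ≤ a → a ≤ n / 2 → a < n
  ≤n/2⇒<n {a} 1≤a a≤n/2 = ℕ.<-≤-trans (ℕ.m<m+n a 1≤a) (≤n/2⇒2*≤n a≤n/2)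

  a₁<n : a₁ < n
  a₁<n = ≤n/2⇒<n 1≤a₁ a₁≤n/2

  a₂<n : a₂ < n
  a₂<n = ≤n/2⇒<n 1≤a₂ a₂≤n/2

  0<n : 0 < n
  0<n = ℕ.<-≤-trans 1≤a₁ (ℕ.<⇒≤ a₁<n)

  0<g : 0 < g
  0<g = ℕ.<-trans ℕ.z<s 1<g

  instance
    n≢0 : NonZero n
    n≢0 = ℕ.>-nonZero 0<n

    g≢0 : NonZero g
    g≢0 = ℕ.>-nonZero 0<g

  0<r : 0 < r
  0<r = ℕ.n≢0⇒n>0 λ r≡0 → ℕ.<-irrefl (trans (cong (ℕ._* g) (sym r≡0)) r*g≡n) 0<n

  g∣n : g ∣ n
  g∣n = GCD.gcd∣m g-gcd

  mod-n⇒mod-g : ∀ {a b} → a ≡ b mod n → a ≡ b mod g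
  mod-n⇒mod-g = mod-divisor g∣n

  a₁≡0-mod-g : + a₁ ≡ 0ℤ mod g
  a₁≡0-mod-g = ∣⇒≡0-mod (GCD.gcd∣n g-gcd)

  r*a₁≡0-mod-n : + r * + a₁ ≡ 0ℤ mod n
  r*a₁≡0-mod-n = subst (_≡ 0ℤ mod n) (ℤ.pos-* r a₁) (∣⇒≡0-mod r*g∣r*a₁)
    where
    open import Data.Nat.Divisibility using (*-monoʳ-∣)
    r*g∣r*a₁ : n ∣ r ℕ.* a₁
    r*g∣r*a₁ = subst (_∣ r ℕ.* a₁) r*g≡n (*-monoʳ-∣ r (GCD.gcd∣n g-gcd))

  a₁+a₂≢0-mod-n : + a₁ + + a₂ ≡ 0ℤ mod n → ⊥
  a₁+a₂≢0-mod-n p =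
    a₁≢a₂ (ℕ.≤-antisym (half a₁≤n/2 a₁+a₂≡n) (half a₂≤n/2 (trans (ℕ.+-comm a₂ a₁) a₁+a₂≡n)))
    where
    a₁+a₂≤n : a₁ ℕ.+ a₂ ≤ n
    a₁+a₂≤n = ℕ.≤-trans (ℕ.+-mono-≤ a₁≤n/2 a₂≤n/2) n/2+n/2≤n
    a₁+a₂≡n : a₁ ℕ.+ a₂ ≡ n
    a₁+a₂≡n = ≡0-mod⇒≡modulus (ℕ.<-≤-trans 1≤a₁ (ℕ.m≤m+n a₁ a₂)) a₁+a₂≤n
                (subst (_≡ 0ℤ mod n) (sym (ℤ.pos-+ a₁ a₂)) p)
    half : ∀ {a b} → a ≤ n / 2 → a ℕ.+ b ≡ n → a ≤ b
    half {a} {b} a≤n/2 a+b≡n = ℕ.+-cancelˡ-≤ a a b (ℕ.≤-trans (≤n/2⇒2*≤n a≤n/2) (ℕ.≤-reflexive (sym a+b≡n)))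

  x*a₁+g*a₂≡0-mod-n : + x * + a₁ + + g * + a₂ ≡ 0ℤ mod n
  x*a₁+g*a₂≡0-mod-n = subst (_≡ 0ℤ mod n) lift (∣⇒≡0-mod n∣xa₁+ga₂)
    where
    lift : + (x ℕ.* a₁ ℕ.+ g ℕ.* a₂) ≡ + x * + a₁ + + g * + a₂
    lift = trans (ℤ.pos-+ (x ℕ.* a₁) (g ℕ.* a₂)) (cong₂ _+_ (ℤ.pos-* x a₁) (ℤ.pos-* g a₂))

  U : ℤ
  U = proj₁ (gcd-as-multiple g-gcd)

  U*a₁≡g-mod-n : U * + a₁ ≡ + g mod n
  U*a₁≡g-mod-n = proj₂ (gcd-as-multiple g-gcd)

  a₂⁻¹ : ℤ
  a₂⁻¹ = proj₁ (gcd-as-multiple (gcd-GCD g a₂))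

  a₂⁻¹*a₂≡1-mod-g : a₂⁻¹ * + a₂ ≡ + 1 mod g
  a₂⁻¹*a₂≡1-mod-g = subst (λ d → a₂⁻¹ * + a₂ ≡ + d mod g) g⊥a₂ (proj₂ (gcd-as-multiple (gcd-GCD g a₂)))

  a₂-cancel-mod-g : ∀ {c c′} → c * + a₂ ≡ c′ * + a₂ mod g → c ≡ c′ mod g
  a₂-cancel-mod-g {c} {c′} ca₂≡c′a₂ =
    subst₂ (_≡_mod g) (times-one c) (times-one c′) (*-rescale-mod a₂⁻¹ c c′ a₂⁻¹*a₂≡1-mod-g ca₂≡c′a₂)
    where
    times-one : ∀ c → c * + 1 ≡ c
    times-one = solve-∀

  -- Cylinder coordinates on ℤₙ

  Φ : ℕ → ℕ → ℤ
  Φ i j = + i * + a₁ + + j * + a₂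

  Φ≡-mod-g : ∀ i j → Φ i j ≡ + j * + a₂ mod g
  Φ≡-mod-g i j = begin
    + i * + a₁ + + j * + a₂   ≈⟨ +-congʳ-mod (+ j * + a₂) (*-congˡ-mod (+ i) a₁≡0-mod-g) ⟩
    + i * 0ℤ + + j * + a₂     ≡⟨ drop-0 (+ i) (+ j * + a₂) ⟩
    + j * + a₂                ∎
    where
    open ≡-mod-Reasoning g
    drop-0 : ∀ i c → i * 0ℤ + c ≡ c
    drop-0 = solve-∀

  Φ-injective : ∀ {i i′ j j′} → i < r → i′ < r → j < g → j′ < g →
                Φ i j ≡ Φ i′ j′ mod n → i ≡ i′ × j ≡ j′
  Φ-injective {i} {i′} {j} {j′} i<r i′<r j<g j′<g Φ≡Φ′ = i≡i′ , j≡j′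
    where
    j≡j′ : j ≡ j′
    j≡j′ = mod-injective-< j<g j′<g (a₂-cancel-mod-g (begin
      + j * + a₂   ≈⟨ Φ≡-mod-g i j ⟨
      Φ i j        ≈⟨ mod-n⇒mod-g Φ≡Φ′ ⟩
      Φ i′ j′      ≈⟨ Φ≡-mod-g i′ j′ ⟩
      + j′ * + a₂  ∎))
      where open ≡-mod-Reasoning g
    ia₁≡i′a₁ : + i * + a₁ ≡ + i′ * + a₁ mod n
    ia₁≡i′a₁ = +-cancelʳ-mod (+ j * + a₂) (subst (λ j″ → Φ i j ≡ Φ i′ j″ mod n) (sym j≡j′) Φ≡Φ′)
    ig≡i′g : + i * + g ≡ + i′ * + g mod (r ℕ.* g)
    ig≡i′g = subst (λ m → + i * + g ≡ + i′ * + g mod m) (sym r*g≡n)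
                   (*-rescale-mod U (+ i) (+ i′) U*a₁≡g-mod-n ia₁≡i′a₁)
    i≡i′ : i ≡ i′
    i≡i′ = mod-injective-< i<r i′<r (*-cancelʳ-mod ig≡i′g)

  Φ% : ℕ → ℕ → ℕ
  Φ% i j = (i ℕ.* a₁ ℕ.+ j ℕ.* a₂) % n

  Φ%<n : ∀ i j → Φ% i j < n
  Φ%<n i j = m%n<n _ n

  Φ%≡Φ : ∀ i j → + Φ% i j ≡ Φ i j mod n
  Φ%≡Φ i j = mod-trans (%≡-mod n _) (≡⇒≡-mod (trans (ℤ.pos-+ (i ℕ.* a₁) (j ℕ.* a₂))
                                                     (cong₂ _+_ (ℤ.pos-* i a₁) (ℤ.pos-* j a₂))))

  record Coordinates (v : ℕ) : Set where
    field
      row col : ℕ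
      row<r : row < r
      col<g : col < g
      Φ≡v : Φ row col ≡ + v mod n

  quotient<r : ∀ (k : Fin n) → toℕ k / g < r
  quotient<r k = m<n*o⇒m/o<n (subst (toℕ k <_) (sym r*g≡n) (toℕ<n k))

  -- As r · g = n, the injectivity of Φ on [0 , r) × [0 , g) makes it onto ℤₙ.
  Φ-of-divmod : Fin n → Fin n
  Φ-of-divmod k = fromℕ< (Φ%<n (toℕ k / g) (toℕ k % g))

  Φ-of-divmod-≡ : ∀ k → + toℕ (Φ-of-divmod k) ≡ Φ (toℕ k / g) (toℕ k % g) mod n
  Φ-of-divmod-≡ k =
    subst (_≡ Φ (toℕ k / g) (toℕ k % g) mod n) (cong +_ (sym (toℕ-fromℕ< _))) (Φ%≡Φ (toℕ k / g) (toℕ k % g))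

  Φ-of-divmod-injective : Injective _≡_ _≡_ Φ-of-divmod
  Φ-of-divmod-injective {k} {k′} eq = toℕ-injective (begin
    toℕ k                            ≡⟨ m≡m%n+[m/n]*n (toℕ k) g ⟩
    toℕ k % g ℕ.+ toℕ k / g ℕ.* g    ≡⟨ cong₂ (λ j i → j ℕ.+ i ℕ.* g) (proj₂ same) (proj₁ same) ⟩
    toℕ k′ % g ℕ.+ toℕ k′ / g ℕ.* g  ≡⟨ m≡m%n+[m/n]*n (toℕ k′) g ⟨
    toℕ k′                           ∎)
    where
    open ≡-Reasoning
    same : toℕ k / g ≡ toℕ k′ / g × toℕ k % g ≡ toℕ k′ % g
    same = Φ-injective (quotient<r k) (quotient<r k′) (m%n<n _ g) (m%n<n _ g)
             (mod-trans (mod-sym (Φ-of-divmod-≡ k))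
               (mod-trans (≡⇒≡-mod (cong (λ k → + toℕ k) eq)) (Φ-of-divmod-≡ k′)))

  -- Opaque: only the specification of the coordinates is needed, never the search behind them.
  opaque
    coordinates : ∀ v → Coordinates v
    coordinates v = record
      { row = toℕ k / g ; col = toℕ k % g ; row<r = quotient<r k ; col<g = m%n<n (toℕ k) g
      ; Φ≡v = mod-trans (mod-sym (Φ-of-divmod-≡ k)) (subst (_≡ + v mod n) (sym hits-v) (%≡-mod n v)) }
      where
      preimage : ∃ λ k → Φ-of-divmod k ≡ fromℕ< (m%n<n v n)
      preimage = injective⇒surjective Φ-of-divmod Φ-of-divmod-injective refl (fromℕ< (m%n<n v n))
      k : Fin n
      k = proj₁ preimage
      hits-v : + toℕ (Φ-of-divmod k) ≡ + (v % n)
      hits-v = cong +_ (trans (cong toℕ (proj₂ preimage)) (toℕ-fromℕ< (m%n<n v n)))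

  row col : ℕ → ℕ
  row v = Coordinates.row (coordinates v)
  col v = Coordinates.col (coordinates v)

  row<r : ∀ v → row v < r
  row<r v = Coordinates.row<r (coordinates v)

  col<g : ∀ v → col v < g
  col<g v = Coordinates.col<g (coordinates v)

  Φ-row-col : ∀ v → Φ (row v) (col v) ≡ + v mod n
  Φ-row-col v = Coordinates.Φ≡v (coordinates v)

  coordinates-unique : ∀ {v i j} → i < r → j < g → Φ i j ≡ + v mod n → row v ≡ i × col v ≡ j
  coordinates-unique {v} i<r j<g Φ≡v = Φ-injective (row<r v) i<r (col<g v) j<g (mod-trans (Φ-row-col v) (mod-sym Φ≡v))

  col*a₂≡-mod-g : ∀ v → + col v * + a₂ ≡ + v mod g
  col*a₂≡-mod-g v = mod-trans (mod-sym (Φ≡-mod-g (row v) (col v))) (mod-n⇒mod-g (Φ-row-col v))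

  col-cong : ∀ {u w} → + u ≡ + w mod g → col u ≡ col w
  col-cong {u} {w} u≡w = mod-injective-< (col<g u) (col<g w)
    (a₂-cancel-mod-g (mod-trans (col*a₂≡-mod-g u) (mod-trans u≡w (mod-sym (col*a₂≡-mod-g w)))))

  -- Steps of the circulant graph in coordinates

  Φ-suc-row : ∀ i j → Φ (suc i) j ≡ Φ i j + + a₁
  Φ-suc-row i j = trans (cong (λ z → z * + a₁ + + j * + a₂) (ℤ.pos-+ 1 i)) (shift (+ i) (+ j) (+ a₁) (+ a₂))
    where
    shift : ∀ i j a b → (+ 1 + i) * a + j * b ≡ i * a + j * b + a
    shift = solve-∀

  Φ-suc-col : ∀ i j → Φ i (suc j) ≡ Φ i j + + a₂
  Φ-suc-col i j = trans (cong (λ z → + i * + a₁ + z * + a₂) (ℤ.pos-+ 1 j)) (shift (+ i) (+ j) (+ a₁) (+ a₂))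
    where
    shift : ∀ i j a b → i * a + (+ 1 + j) * b ≡ i * a + j * b + b
    shift = solve-∀

  Φ-r≡Φ-0 : ∀ j → Φ r j ≡ Φ 0 j mod n
  Φ-r≡Φ-0 j = begin
    + r * + a₁ + + j * + a₂   ≈⟨ +-congʳ-mod (+ j * + a₂) r*a₁≡0-mod-n ⟩
    0ℤ + + j * + a₂           ≡⟨ zero-row (+ a₁) (+ j * + a₂) ⟩
    Φ 0 j                     ∎
    where
    open ≡-mod-Reasoning n
    zero-row : ∀ a c → 0ℤ + c ≡ + 0 * a + c
    zero-row = solve-∀

  Φ-end+a₂≡0 : Φ x (g ∸ 1) + + a₂ ≡ 0ℤ mod n
  Φ-end+a₂≡0 = begin
    Φ x (g ∸ 1) + + a₂         ≡⟨ Φ-suc-col x (g ∸ 1) ⟨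
    Φ x (suc (g ∸ 1))          ≡⟨ cong (Φ x) (ℕ.suc-pred g) ⟩
    Φ x g                      ≈⟨ x*a₁+g*a₂≡0-mod-n ⟩
    0ℤ                         ∎
    where open ≡-mod-Reasoning n

  a₁-step : ∀ u w → + u + + a₁ ≡ + w mod n → col w ≡ col u × StepMod r 1 (row u) (row w)
  a₁-step u w u+a₁≡w with suc (row u) ℕ.<? r
  ... | yes next<r = proj₂ at-next , inj₁ (trans (ℕ.+-comm (row u) 1) (sym (proj₁ at-next)))
    where
    at-next : row w ≡ suc (row u) × col w ≡ col u
    at-next = coordinates-unique next<r (col<g u) (mod-trans (Φ-next-row u) u+a₁≡w)
      where
      Φ-next-row : ∀ u → Φ (suc (row u)) (col u) ≡ + u + + a₁ mod n
      Φ-next-row u = mod-trans (≡⇒≡-mod (Φ-suc-row (row u) (col u))) (+-congʳ-mod (+ a₁) (Φ-row-col u))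
  ... | no next≮r = proj₂ at-0 , inj₂ (trans (ℕ.+-comm (row u) 1) (trans next≡r (cong (ℕ._+ r) (sym (proj₁ at-0)))))
    where
    next≡r : suc (row u) ≡ r
    next≡r = ℕ.≤-antisym (row<r u) (ℕ.≮⇒≥ next≮r)
    at-0 : row w ≡ 0 × col w ≡ col u
    at-0 = coordinates-unique 0<r (col<g u) (begin
      Φ 0 (col u)                ≈⟨ Φ-r≡Φ-0 (col u) ⟨
      Φ r (col u)                ≡⟨ cong (λ i → Φ i (col u)) (sym next≡r) ⟩
      Φ (suc (row u)) (col u)    ≡⟨ Φ-suc-row (row u) (col u) ⟩
      Φ (row u) (col u) + + a₁   ≈⟨ +-congʳ-mod (+ a₁) (Φ-row-col u) ⟩
      + u + + a₁                 ≈⟨ u+a₁≡w ⟩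
      + w                        ∎)
      where open ≡-mod-Reasoning n

  a₂-step-col : ∀ u w → + u + + a₂ ≡ + w mod n → StepMod g 1 (col u) (col w)
  a₂-step-col u w u+a₂≡w = mod⇒StepMod (col<g u) (col<g w) (ℕ.<⇒≤ 1<g) (a₂-cancel-mod-g (begin
    (+ col u + + 1) * + a₂      ≡⟨ distrib (+ col u) (+ a₂) ⟩
    + col u * + a₂ + + a₂       ≈⟨ +-congʳ-mod (+ a₂) (col*a₂≡-mod-g u) ⟩
    + u + + a₂                  ≈⟨ mod-n⇒mod-g u+a₂≡w ⟩
    + w                         ≈⟨ col*a₂≡-mod-g w ⟨
    + col w * + a₂              ∎))
    where
    open ≡-mod-Reasoning g
    distrib : ∀ c a → (c + + 1) * a ≡ c * a + a
    distrib = solve-∀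

  a₂-step-inner : ∀ u w → + u + + a₂ ≡ + w mod n → suc (col u) < g → row w ≡ row u × col w ≡ suc (col u)
  a₂-step-inner u w u+a₂≡w next<g = coordinates-unique (row<r u) next<g (begin
    Φ (row u) (suc (col u))     ≡⟨ Φ-suc-col (row u) (col u) ⟩
    Φ (row u) (col u) + + a₂    ≈⟨ +-congʳ-mod (+ a₂) (Φ-row-col u) ⟩
    + u + + a₂                  ≈⟨ u+a₂≡w ⟩
    + w                         ∎)
    where open ≡-mod-Reasoning n

  Edge : ℕ → ℕ → ℕ → Set
  Edge a u w = StepMod n a u w ⊎ StepMod n a w u

  edge? : ∀ a u w → Dec (Edge a u w)
  edge? a u w = stepMod? n a u w ⊎-dec stepMod? n a w u

  Edge-sym : ∀ {a u w} → Edge a u w → Edge a w u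
  Edge-sym (inj₁ step) = inj₂ step
  Edge-sym (inj₂ step) = inj₁ step

  a₁-edge⇒same-col : ∀ u w → Edge a₁ u w → col w ≡ col u
  a₁-edge⇒same-col u w (inj₁ step) = proj₁ (a₁-step u w (StepMod⇒mod a₁ u w step))
  a₁-edge⇒same-col u w (inj₂ step) = sym (proj₁ (a₁-step w u (StepMod⇒mod a₁ w u step)))

  ¬a₁-edge×a₂-edge : ∀ u w → Edge a₁ u w → Edge a₂ u w → ⊥
  ¬a₁-edge×a₂-edge u w (inj₁ s₁) (inj₁ s₂) = same-step (StepMod⇒mod a₁ u w s₁) (StepMod⇒mod a₂ u w s₂)
    where
    same-step : + u + + a₁ ≡ + w mod n → + u + + a₂ ≡ + w mod n → ⊥
    same-step p q = a₁≢a₂ (mod-injective-< a₁<n a₂<n (+-cancelˡ-mod (+ u) (mod-trans p (mod-sym q))))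
  ¬a₁-edge×a₂-edge u w (inj₂ s₁) (inj₂ s₂) = ¬a₁-edge×a₂-edge w u (inj₁ s₁) (inj₁ s₂)
  ¬a₁-edge×a₂-edge u w (inj₁ s₁) (inj₂ s₂) =
    a₁+a₂≢0-mod-n (round-trip-mod (+ u) (+ a₁) (+ a₂) (StepMod⇒mod a₁ u w s₁) (StepMod⇒mod a₂ w u s₂))
  ¬a₁-edge×a₂-edge u w (inj₂ s₁) (inj₁ s₂) =
    a₁+a₂≢0-mod-n (mod-trans (≡⇒≡-mod (ℤ.+-comm (+ a₁) (+ a₂)))
                            (round-trip-mod (+ u) (+ a₂) (+ a₁) (StepMod⇒mod a₂ u w s₂) (StepMod⇒mod a₁ w u s₁)))

  a₂-there-and-back⇒g≤2 : ∀ u w → StepMod n a₂ u w → StepMod n a₂ w u → g ≤ 2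
  a₂-there-and-back⇒g≤2 u w there back with 2 ℕ.<? g
  ... | no 2≮g = ℕ.≮⇒≥ 2≮g
  ... | yes 2<g = ⊥-elim (ℕ.1+n≢0 (mod-injective-< 2<g 0<g (a₂-cancel-mod-g (begin
    + 2 * + a₂       ≡⟨ double (+ a₂) ⟩
    + a₂ + + a₂      ≈⟨ mod-n⇒mod-g (round-trip-mod (+ u) (+ a₂) (+ a₂)
                          (StepMod⇒mod a₂ u w there) (StepMod⇒mod a₂ w u back)) ⟩
    0ℤ               ≡⟨ zero-times (+ a₂) ⟩
    + 0 * + a₂       ∎))))
    where
    open ≡-mod-Reasoning g
    double : ∀ a → + 2 * a ≡ a + a
    double = solve-∀
    zero-times : ∀ a → 0ℤ ≡ + 0 * a
    zero-times = solve-∀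

  -- Cylinder paths close up to Hamiltonian cycles

  vertex : CylVertex r g → ℕ
  vertex (i , j) = Φ% (toℕ i) (toℕ j)

  vertex≡Φ : ∀ P → + vertex P ≡ Φ (toℕ (proj₁ P)) (toℕ (proj₂ P)) mod n
  vertex≡Φ (i , j) = Φ%≡Φ (toℕ i) (toℕ j)

  vertex-injective : Injective _≡_ _≡_ vertex
  vertex-injective {i , j} {i′ , j′} eq = cong₂ _,_ (toℕ-injective (proj₁ same)) (toℕ-injective (proj₂ same))
    where
    same : toℕ i ≡ toℕ i′ × toℕ j ≡ toℕ j′
    same = Φ-injective (toℕ<n i) (toℕ<n i′) (toℕ<n j) (toℕ<n j′)
             (mod-trans (mod-sym (vertex≡Φ (i , j))) (mod-trans (≡⇒≡-mod (cong +_ eq)) (vertex≡Φ (i′ , j′))))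

  Φ-row-step : ∀ {i i′} j → StepMod r 1 i i′ → Φ i j + + a₁ ≡ Φ i′ j mod n
  Φ-row-step {i} j (inj₁ i+1≡i′) = ≡⇒≡-mod (trans (sym (Φ-suc-row i j)) (cong (λ i → Φ i j) (trans (ℕ.+-comm 1 i) i+1≡i′)))
  Φ-row-step {i} {i′} j (inj₂ i+1≡i′+r) = begin
    Φ i j + + a₁                 ≡⟨ Φ-suc-row i j ⟨
    Φ (suc i) j                  ≡⟨ cong (λ i → Φ i j) (trans (ℕ.+-comm 1 i) i+1≡i′+r) ⟩
    Φ (i′ ℕ.+ r) j               ≡⟨ cong (λ z → z * + a₁ + + j * + a₂) (ℤ.pos-+ i′ r) ⟩
    (+ i′ + + r) * + a₁ + + j * + a₂  ≡⟨ regroup (+ i′) (+ r) (+ a₁) (+ j) (+ a₂) ⟩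
    Φ i′ j + + r * + a₁          ≈⟨ +-congˡ-mod (Φ i′ j) r*a₁≡0-mod-n ⟩
    Φ i′ j + 0ℤ                  ≡⟨ ℤ.+-identityʳ (Φ i′ j) ⟩
    Φ i′ j                       ∎
    where
    open ≡-mod-Reasoning n
    regroup : ∀ i r a j b → (i + r) * a + j * b ≡ (i * a + j * b) + r * a
    regroup = solve-∀

  vertex<n : ∀ P → vertex P < n
  vertex<n (i , j) = Φ%<n (toℕ i) (toℕ j)

  vertex-step : ∀ {a} P Q → a < n → + vertex P + + a ≡ + vertex Q mod n → StepMod n a (vertex P) (vertex Q)
  vertex-step P Q a<n = mod⇒StepMod (vertex<n P) (vertex<n Q) (ℕ.<⇒≤ a<n)

  horizontal⇒a₂-edge : ∀ P Q → Horiz P Q → Edge a₂ (vertex P) (vertex Q)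
  horizontal⇒a₂-edge (i , j) (i′ , j′) (i≡i′ , inj₁ j+1≡j′) = inj₁ (vertex-step (i , j) (i′ , j′) a₂<n (begin
    + vertex (i , j) + + a₂         ≈⟨ +-congʳ-mod (+ a₂) (vertex≡Φ (i , j)) ⟩
    Φ (toℕ i) (toℕ j) + + a₂        ≡⟨ Φ-suc-col (toℕ i) (toℕ j) ⟨
    Φ (toℕ i) (suc (toℕ j))         ≡⟨ cong₂ Φ i≡i′ j+1≡j′ ⟩
    Φ (toℕ i′) (toℕ j′)             ≈⟨ vertex≡Φ (i′ , j′) ⟨
    + vertex (i′ , j′)              ∎))
    where open ≡-mod-Reasoning n
  horizontal⇒a₂-edge (i , j) (i′ , j′) (i≡i′ , inj₂ j′+1≡j) =
    Edge-sym (horizontal⇒a₂-edge (i′ , j′) (i , j) (sym i≡i′ , inj₁ j′+1≡j))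

  vertical⇒a₁-edge : ∀ P Q → Vert P Q → Edge a₁ (vertex P) (vertex Q)
  vertical⇒a₁-edge (i , j) (i′ , j′) (j≡j′ , inj₁ step) = inj₁ (vertex-step (i , j) (i′ , j′) a₁<n (begin
    + vertex (i , j) + + a₁         ≈⟨ +-congʳ-mod (+ a₁) (vertex≡Φ (i , j)) ⟩
    Φ (toℕ i) (toℕ j) + + a₁        ≈⟨ Φ-row-step (toℕ j) step ⟩
    Φ (toℕ i′) (toℕ j)              ≡⟨ cong (Φ (toℕ i′)) j≡j′ ⟩
    Φ (toℕ i′) (toℕ j′)             ≈⟨ vertex≡Φ (i′ , j′) ⟨
    + vertex (i′ , j′)              ∎))
    where open ≡-mod-Reasoning n
  vertical⇒a₁-edge (i , j) (i′ , j′) (j≡j′ , inj₂ step) =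
    Edge-sym (vertical⇒a₁-edge (i′ , j′) (i , j) (sym j≡j′ , inj₁ step))

  adjacent⇒edge : ∀ P Q → CylAdj P Q → Edge a₁ (vertex P) (vertex Q) ⊎ Edge a₂ (vertex P) (vertex Q)
  adjacent⇒edge P Q (inj₁ horizontal) = inj₂ (horizontal⇒a₂-edge P Q horizontal)
  adjacent⇒edge P Q (inj₂ vertical) = inj₁ (vertical⇒a₁-edge P Q vertical)

  adjacent⇒a₂-edge≡horizontal : ∀ P Q → CylAdj P Q → does (edge? a₂ (vertex P) (vertex Q)) ≡ does (horiz? P Q)
  adjacent⇒a₂-edge≡horizontal P Q (inj₁ horizontal) =
    trans (dec-true (edge? a₂ _ _) (horizontal⇒a₂-edge P Q horizontal)) (sym (dec-true (horiz? P Q) horizontal))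
  adjacent⇒a₂-edge≡horizontal P Q (inj₂ vertical) =
    trans (dec-false (edge? a₂ _ _) (¬a₁-edge×a₂-edge _ _ (vertical⇒a₁-edge P Q vertical)))
          (sym (dec-false (horiz? P Q) (vertical⇒¬horizontal vertical)))
    where
    vertical⇒¬horizontal : ∀ {P Q : CylVertex r g} → Vert P Q → ¬ Horiz P Q
    vertical⇒¬horizontal (j≡j′ , _) (_ , inj₁ j+1≡j′) = ℕ.1+n≢n (trans j+1≡j′ (sym j≡j′))
    vertical⇒¬horizontal (j≡j′ , _) (_ , inj₂ j′+1≡j) = ℕ.1+n≢n (trans j′+1≡j j≡j′)

  path⇒cycle : ∀ {h} → HamPathCyl r g h 0 0 x (g ∸ 1) → HamCycleOfCost n a₁ a₂ (suc h)
  path⇒cycle {h} (L , L+1≡rg , π , π-injective , adjacent , start-row , start-col , end-row , end-col , horizontals) =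
    L , trans L+1≡rg r*g≡n , σ , σ-injective , edges , cost
    where
    σ : Fin (suc L) → Fin n
    σ q = fromℕ< (vertex<n (π q))

    σ≡vertex : ∀ q → toℕ (σ q) ≡ vertex (π q)
    σ≡vertex q = toℕ-fromℕ< _

    σ-injective : Injective _≡_ _≡_ σ
    σ-injective eq = π-injective (vertex-injective (trans (sym (σ≡vertex _)) (trans (cong toℕ eq) (σ≡vertex _))))

    adjacent-at : ∀ i → CylAdj (π (inject₁ i)) (π (fsuc i))
    adjacent-at = tabulate⁻ (map⁻ adjacent)

    closing : StepMod n a₂ (toℕ (σ (fromℕ L))) (toℕ (σ fzero))
    closing = subst₂ (StepMod n a₂) (sym (σ≡vertex _)) (sym (σ≡vertex _)) (vertex-step last first a₂<n (begin
      + vertex last + + a₂                        ≈⟨ +-congʳ-mod (+ a₂) (vertex≡Φ last) ⟩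
      Φ (toℕ (proj₁ last)) (toℕ (proj₂ last)) + + a₂ ≡⟨ cong₂ (λ i j → Φ i j + + a₂) end-row end-col ⟩
      Φ x (g ∸ 1) + + a₂                          ≈⟨ Φ-end+a₂≡0 ⟩
      0ℤ                                          ≡⟨ cong₂ Φ start-row start-col ⟨
      Φ (toℕ (proj₁ first)) (toℕ (proj₂ first))   ≈⟨ vertex≡Φ first ⟨
      + vertex first                              ∎))
      where
      open ≡-mod-Reasoning n
      first last : CylVertex r g
      first = π fzero
      last = π (fromℕ L)

    edges : All (λ e → CircEdge n a₁ (proj₁ e) (proj₂ e) ⊎ CircEdge n a₂ (proj₁ e) (proj₂ e)) (cycleEdges L σ)
    edges = ++⁺ (map⁺ (tabulate⁺ λ i → subst₂ (λ u w → Edge a₁ u w ⊎ Edge a₂ u w) (sym (σ≡vertex _)) (sym (σ≡vertex _))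
                                          (adjacent⇒edge _ _ (adjacent-at i))))
                (inj₂ (inj₁ closing) ∷ [])

    cost : length (filter (λ e → circEdge? n a₂ (proj₁ e) (proj₂ e)) (cycleEdges L σ)) ≡ suc h
    cost = begin
      length (filter a₂? (cycleEdges L σ))                        ≡⟨ length-filter-snoc a₂? (pathEdges L σ) _ ⟩
      length (filter a₂? (pathEdges L σ)) ℕ.+ 𝟙 (does (a₂? (σ (fromℕ L) , σ fzero)))
                                                                  ≡⟨ cong₂ ℕ._+_ path-part (cong 𝟙 (dec-true (a₂? _) (inj₁ closing))) ⟩
      h ℕ.+ 1                                                     ≡⟨ ℕ.+-comm h 1 ⟩
      suc h                                                       ∎
      where
      open ≡-Reasoning
      a₂? : Decidable (λ (e : Fin n × Fin n) → CircEdge n a₂ (proj₁ e) (proj₂ e))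
      a₂? e = circEdge? n a₂ (proj₁ e) (proj₂ e)
      path-part : length (filter a₂? (pathEdges L σ)) ≡ h
      path-part = trans (length-filter-cong a₂? (λ e → horiz? (proj₁ e) (proj₂ e)) L _ _
                           (λ i → trans (cong₂ (λ u w → does (edge? a₂ u w)) (σ≡vertex _) (σ≡vertex _))
                                        (adjacent⇒a₂-edge≡horizontal _ _ (adjacent-at i))))
                        horizontals

  -- Hamiltonian cycles of small cost cut open to cylinder paths

  -- An a₂-edge {u , w} is oriented by the step u + a₂ ≡ w (or else w + a₂ ≡ u); it leaves the
  -- column of its tail.
  tail-col : ℕ → ℕ → ℕ
  tail-col u w = if does (stepMod? n a₂ u w) then col u else col w

  leaves-column : ℕ → ℕ → ℕ → Bool
  leaves-column t u w = does (edge? a₂ u w) ∧ does (tail-col u w ℕ.≟ t)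

  tail-col<g : ∀ u w → tail-col u w < g
  tail-col<g u w with does (stepMod? n a₂ u w)
  ... | true = col<g u
  ... | false = col<g w

  leaves-column⇒ : ∀ t u w → leaves-column t u w ≡ true → Edge a₂ u w × tail-col u w ≡ t
  leaves-column⇒ t u w = both (edge? a₂ u w) (tail-col u w ℕ.≟ t)
    where
    both : ∀ {P Q : Set} (p? : Dec P) (q? : Dec Q) → does p? ∧ does q? ≡ true → P × Q
    both (yes p) (yes q) _ = p , q
    both (yes _) (no _) ()
    both (no _) _ ()

  tail-col-forward : ∀ u w → StepMod n a₂ u w → tail-col u w ≡ col u
  tail-col-forward u w step = cong (λ b → if b then col u else col w) (dec-true (stepMod? n a₂ u w) step)

  tail-col-backward : ∀ u w → ¬ StepMod n a₂ u w → tail-col u w ≡ col w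
  tail-col-backward u w ¬step = cong (λ b → if b then col u else col w) (dec-false (stepMod? n a₂ u w) ¬step)

  a₂-edge-backward : ∀ u w → Edge a₂ u w → ¬ StepMod n a₂ u w → StepMod n a₂ w u
  a₂-edge-backward u w (inj₁ step) ¬step = ⊥-elim (¬step step)
  a₂-edge-backward u w (inj₂ step) ¬step = step

  leaves-column-forward : ∀ t u w → StepMod n a₂ u w → leaves-column t u w ≡ does (col u ℕ.≟ t)
  leaves-column-forward t u w step =
    cong₂ (λ e c → e ∧ does (c ℕ.≟ t)) (dec-true (edge? a₂ u w) (inj₁ step)) (tail-col-forward u w step)

  leaves-column-backward : ∀ t u w → Edge a₂ u w → ¬ StepMod n a₂ u w → leaves-column t u w ≡ does (col w ℕ.≟ t)
  leaves-column-backward t u w a₂-edge ¬step =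
    cong₂ (λ e c → e ∧ does (c ℕ.≟ t)) (dec-true (edge? a₂ u w) a₂-edge) (tail-col-backward u w ¬step)

  stays-forward : ∀ t u w → leaves-column t u w ≡ false → StepMod n a₂ u w → col u ≢ t
  stays-forward t u w stays step col≡t with () ← trans (sym stays)
    (trans (leaves-column-forward t u w step) (dec-true (col u ℕ.≟ t) col≡t))

  stays-backward : ∀ t u w → leaves-column t u w ≡ false → Edge a₂ u w → ¬ StepMod n a₂ u w → col w ≢ t
  stays-backward t u w stays a₂-edge ¬step col≡t with () ← trans (sym stays)
    (trans (leaves-column-backward t u w a₂-edge ¬step) (dec-true (col w ℕ.≟ t) col≡t))

  leaves-column-a₁ : ∀ t u w → Edge a₁ u w → leaves-column t u w ≡ false
  leaves-column-a₁ t u w a₁-edge = cong (_∧ does (tail-col u w ℕ.≟ t)) (dec-false (edge? a₂ u w) (¬a₁-edge×a₂-edge u w a₁-edge))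

  edge?-sym : ∀ a u w → does (edge? a u w) ≡ does (edge? a w u)
  edge?-sym a u w = ∨-comm (does (stepMod? n a u w)) (does (stepMod? n a w u))

  leaves-column-sym : 3 ≤ g → ∀ t u w → leaves-column t u w ≡ leaves-column t w u
  leaves-column-sym 3≤g t u w = one-way-symmetric (stepMod? n a₂ u w) (stepMod? n a₂ w u) (λ c → does (c ℕ.≟ t))
    (λ there back → ℕ.<-irrefl refl (ℕ.<-≤-trans 3≤g (a₂-there-and-back⇒g≤2 u w there back)))
    where
    one-way-symmetric : ∀ {P Q : Set} (p? : Dec P) (q? : Dec Q) (f : ℕ → Bool) → (P → Q → ⊥) →
                        (does p? ∨ does q?) ∧ f (if does p? then col u else col w) ≡
                        (does q? ∨ does p?) ∧ f (if does q? then col w else col u)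
    one-way-symmetric (yes p) (yes q) f one-way = ⊥-elim (one-way p q)
    one-way-symmetric (yes _) (no _) f one-way = refl
    one-way-symmetric (no _) (yes _) f one-way = refl
    one-way-symmetric (no _) (no _) f one-way = refl

  crossing : ∀ {p q} u w → p < q → q < g → Edge a₁ u w ⊎ Edge a₂ u w →
             𝟙 (in-interval p q (col u) xor in-interval p q (col w)) ≡ 𝟙 (leaves-column p u w) ℕ.+ 𝟙 (leaves-column q u w)
  crossing {p} {q} u w p<q q<g (inj₁ a₁-edge) = begin
    𝟙 (in-interval p q (col u) xor in-interval p q (col w))  ≡⟨ cong (λ c → 𝟙 (in-interval p q (col u) xor in-interval p q c))
                                                                     (a₁-edge⇒same-col u w a₁-edge) ⟩
    𝟙 (in-interval p q (col u) xor in-interval p q (col u))  ≡⟨ cong 𝟙 (xor-same (in-interval p q (col u))) ⟩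
    0                                                        ≡⟨ cong₂ (λ b b′ → 𝟙 b ℕ.+ 𝟙 b′) (leaves-column-a₁ p u w a₁-edge)
                                                                      (leaves-column-a₁ q u w a₁-edge) ⟨
    𝟙 (leaves-column p u w) ℕ.+ 𝟙 (leaves-column q u w)      ∎
    where open ≡-Reasoning
  crossing {p} {q} u w p<q q<g (inj₂ a₂-edge) with stepMod? n a₂ u w
  ... | yes forward = begin
    𝟙 (in-interval p q (col u) xor in-interval p q (col w))  ≡⟨ in-interval-step g p q (col u) (col w) p<q q<g (col<g u)
                                                                  (a₂-step-col u w (StepMod⇒mod a₂ u w forward)) ⟩
    𝟙 (does (col u ℕ.≟ p)) ℕ.+ 𝟙 (does (col u ℕ.≟ q))        ≡⟨ cong₂ (λ b b′ → 𝟙 b ℕ.+ 𝟙 b′) (leaves-column-forward p u w forward)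
                                                                      (leaves-column-forward q u w forward) ⟨
    𝟙 (leaves-column p u w) ℕ.+ 𝟙 (leaves-column q u w)      ∎
    where open ≡-Reasoning
  ... | no ¬forward = begin
    𝟙 (in-interval p q (col u) xor in-interval p q (col w))  ≡⟨ cong 𝟙 (xor-comm (in-interval p q (col u)) _) ⟩
    𝟙 (in-interval p q (col w) xor in-interval p q (col u))  ≡⟨ in-interval-step g p q (col w) (col u) p<q q<g (col<g w)
                                                                  (a₂-step-col w u (StepMod⇒mod a₂ w u backward)) ⟩
    𝟙 (does (col w ℕ.≟ p)) ℕ.+ 𝟙 (does (col w ℕ.≟ q))        ≡⟨ cong₂ (λ b b′ → 𝟙 b ℕ.+ 𝟙 b′) (leaves-column-backward p u w a₂-edge ¬forward)
                                                                      (leaves-column-backward q u w a₂-edge ¬forward) ⟨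
    𝟙 (leaves-column p u w) ℕ.+ 𝟙 (leaves-column q u w)      ∎
    where
    open ≡-Reasoning
    backward = a₂-edge-backward u w a₂-edge ¬forward

  cell : ℕ → CylVertex r g
  cell v = fromℕ< (row<r v) , fromℕ< (col<g v)

  cell-row : ∀ v → toℕ (proj₁ (cell v)) ≡ row v
  cell-row v = toℕ-fromℕ< (row<r v)

  cell-col : ∀ v → toℕ (proj₂ (cell v)) ≡ col v
  cell-col v = toℕ-fromℕ< (col<g v)

  cell-horizontal : ∀ u w → row u ≡ row w → suc (col u) ≡ col w ⊎ suc (col w) ≡ col u → Horiz (cell u) (cell w)
  cell-horizontal u w same-row adjacent-col
    rewrite cell-row u | cell-row w | cell-col u | cell-col w = same-row , adjacent-col

  cell-vertical : ∀ u w → col u ≡ col w → StepMod r 1 (row u) (row w) ⊎ StepMod r 1 (row w) (row u) → Vert (cell u) (cell w)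
  cell-vertical u w same-col adjacent-row
    rewrite cell-row u | cell-row w | cell-col u | cell-col w = same-col , adjacent-row

  horizontal⇒col≢ : ∀ {P Q : CylVertex r g} → Horiz P Q → toℕ (proj₂ P) ≢ toℕ (proj₂ Q)
  horizontal⇒col≢ (_ , inj₁ j+1≡j′) j≡j′ = ℕ.1+n≢n (trans j+1≡j′ (sym j≡j′))
  horizontal⇒col≢ (_ , inj₂ j′+1≡j) j≡j′ = ℕ.1+n≢n (trans j′+1≡j j≡j′)

  cell-injective : ∀ u w → cell u ≡ cell w → + u ≡ + w mod n
  cell-injective u w same = begin
    + u                    ≈⟨ Φ-row-col u ⟨
    Φ (row u) (col u)      ≡⟨ cong₂ Φ same-row same-col ⟩
    Φ (row w) (col w)      ≈⟨ Φ-row-col w ⟩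
    + w                    ∎
    where
    open ≡-mod-Reasoning n
    same-row : row u ≡ row w
    same-row = trans (sym (cell-row u)) (trans (cong (λ P → toℕ (proj₁ P)) same) (cell-row w))
    same-col : col u ≡ col w
    same-col = trans (sym (cell-col u)) (trans (cong (λ P → toℕ (proj₂ P)) same) (cell-col w))

  -- Translating by − τ 0 moves the start of τ to (0 , 0) and, by the closing edge, its end
  -- to (x , g − 1); since no a₂-edge of τ leaves column t, none of the shifted path wraps.
  module CutPath (L : ℕ) (L+1≡n : suc L ≡ n) (τ : ℕ → ℕ) (τ<n : ∀ p → τ p < n)
                 (τ-injective : ∀ p p′ → p < suc L → p′ < suc L → τ p ≡ τ p′ → p ≡ p′)
                 (t : ℕ)
                 (edges : ∀ p → p < L → Edge a₁ (τ p) (τ (suc p)) ⊎ Edge a₂ (τ p) (τ (suc p)))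
                 (stays : ∀ p → p < L → leaves-column t (τ p) (τ (suc p)) ≡ false)
                 (closing : StepMod n a₂ (τ L) (τ 0))
                 (closing-col : col (τ L) ≡ t) where

    shift : ℕ → ℕ
    shift v = v ℕ.+ (n ∸ τ 0)

    shift-back : ∀ v → + shift v + + τ 0 ≡ + v mod n
    shift-back v = begin
      + shift v + + τ 0     ≡⟨ ℤ.pos-+ (shift v) (τ 0) ⟨
      + (shift v ℕ.+ τ 0)   ≡⟨ cong +_ (trans (ℕ.+-assoc v _ (τ 0)) (cong (v ℕ.+_) (ℕ.m∸n+n≡m (ℕ.<⇒≤ (τ<n 0))))) ⟩
      + (v ℕ.+ n)           ≡⟨ ℤ.pos-+ v n ⟩
      + v + + n             ≈⟨ +-congˡ-mod (+ v) modulus≡0-mod ⟩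
      + v + 0ℤ              ≡⟨ ℤ.+-identityʳ (+ v) ⟩
      + v                   ∎
      where open ≡-mod-Reasoning n

    shift-step : ∀ u w a → + u + + a ≡ + w mod n → + shift u + + a ≡ + shift w mod n
    shift-step u w a u+a≡w = +-cancelʳ-mod (+ τ 0) (begin
      + shift u + + a + + τ 0    ≡⟨ swap (+ shift u) (+ a) (+ τ 0) ⟩
      + shift u + + τ 0 + + a    ≈⟨ +-congʳ-mod (+ a) (shift-back u) ⟩
      + u + + a                  ≈⟨ u+a≡w ⟩
      + w                        ≈⟨ shift-back w ⟨
      + shift w + + τ 0          ∎)
      where
      open ≡-mod-Reasoning n
      swap : ∀ s a b → s + a + b ≡ s + b + a
      swap = solve-∀

    shift-first : + shift (τ 0) ≡ 0ℤ mod n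
    shift-first = mod-trans (≡⇒≡-mod (cong +_ (ℕ.m+[n∸m]≡n (ℕ.<⇒≤ (τ<n 0))))) modulus≡0-mod

    shift-closing : + shift (τ L) + + a₂ ≡ 0ℤ mod n
    shift-closing = mod-trans (shift-step (τ L) (τ 0) a₂ (StepMod⇒mod a₂ (τ L) (τ 0) closing)) shift-first

    -- The closing edge makes column g - 1 of the shifted path the column t of the original one.
    last-col : ∀ u → col (shift u) ≡ g ∸ 1 → col u ≡ t
    last-col u col≡g-1 = trans (col-cong (begin
      + u                                 ≈⟨ mod-n⇒mod-g (shift-back u) ⟨
      + shift u + + τ 0                   ≈⟨ +-congʳ-mod (+ τ 0) (col*a₂≡-mod-g (shift u)) ⟨
      + col (shift u) * + a₂ + + τ 0      ≡⟨ cong (λ c → + c * + a₂ + + τ 0) col≡g-1 ⟩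
      + (g ∸ 1) * + a₂ + + τ 0            ≈⟨ +-congˡ-mod (+ (g ∸ 1) * + a₂) (mod-n⇒mod-g (StepMod⇒mod a₂ (τ L) (τ 0) closing)) ⟨
      + (g ∸ 1) * + a₂ + (+ τ L + + a₂)   ≡⟨ regroup (+ (g ∸ 1)) (+ a₂) (+ τ L) ⟩
      (+ (g ∸ 1) + + 1) * + a₂ + + τ L    ≡⟨ cong (λ c → c * + a₂ + + τ L) g-1+1≡g ⟩
      + g * + a₂ + + τ L                  ≈⟨ +-congʳ-mod (+ τ L) (mod-trans (≡⇒≡-mod (ℤ.*-comm (+ g) (+ a₂))) (multiple≡0-mod (+ a₂))) ⟩
      0ℤ + + τ L                          ≡⟨ ℤ.+-identityˡ (+ τ L) ⟩
      + τ L                               ∎)) closing-col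
      where
      open ≡-mod-Reasoning g
      regroup : ∀ c a v → c * a + (v + a) ≡ (c + + 1) * a + v
      regroup = solve-∀
      g-1+1≡g : + (g ∸ 1) + + 1 ≡ + g
      g-1+1≡g = trans (sym (ℤ.pos-+ (g ∸ 1) 1)) (cong +_ (ℕ.m∸n+n≡m (ℕ.<⇒≤ 1<g)))

    R C : ℕ → ℕ
    R p = row (shift (τ p))
    C p = col (shift (τ p))

    no-wrap : ∀ p → col (τ p) ≢ t → suc (C p) < g
    no-wrap p col≢t with suc (C p) ℕ.<? g
    ... | yes next<g = next<g
    ... | no next≮g = ⊥-elim (col≢t (last-col (τ p) (cong ℕ.pred (ℕ.≤-antisym (col<g _) (ℕ.≮⇒≥ next≮g)))))

    π′ : ℕ → CylVertex r g
    π′ p = cell (shift (τ p))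

    vertical-at : ∀ p → Edge a₁ (τ p) (τ (suc p)) → Vert (π′ p) (π′ (suc p))
    vertical-at p (inj₁ step) = cell-vertical _ _ (sym (proj₁ moved)) (inj₁ (proj₂ moved))
      where
      moved : C (suc p) ≡ C p × StepMod r 1 (R p) (R (suc p))
      moved = a₁-step _ _ (shift-step (τ p) (τ (suc p)) a₁ (StepMod⇒mod a₁ (τ p) (τ (suc p)) step))
    vertical-at p (inj₂ step) = cell-vertical _ _ (proj₁ moved) (inj₂ (proj₂ moved))
      where
      moved : C p ≡ C (suc p) × StepMod r 1 (R (suc p)) (R p)
      moved = a₁-step _ _ (shift-step (τ (suc p)) (τ p) a₁ (StepMod⇒mod a₁ (τ (suc p)) (τ p) step))

    horizontal-at : ∀ p → p < L → Edge a₂ (τ p) (τ (suc p)) → Horiz (π′ p) (π′ (suc p))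
    horizontal-at p p<L a₂-edge with stepMod? n a₂ (τ p) (τ (suc p))
    ... | yes forward = cell-horizontal _ _ (sym (proj₁ moved)) (inj₁ (sym (proj₂ moved)))
      where
      moved : R (suc p) ≡ R p × C (suc p) ≡ suc (C p)
      moved = a₂-step-inner _ _ (shift-step (τ p) (τ (suc p)) a₂ (StepMod⇒mod a₂ (τ p) (τ (suc p)) forward))
                (no-wrap p (stays-forward t (τ p) (τ (suc p)) (stays p p<L) forward))
    ... | no ¬forward = cell-horizontal _ _ (proj₁ moved) (inj₂ (sym (proj₂ moved)))
      where
      backward = a₂-edge-backward (τ p) (τ (suc p)) a₂-edge ¬forward
      moved : R p ≡ R (suc p) × C p ≡ suc (C (suc p))
      moved = a₂-step-inner _ _ (shift-step (τ (suc p)) (τ p) a₂ (StepMod⇒mod a₂ (τ (suc p)) (τ p) backward))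
                (no-wrap (suc p) (stays-backward t (τ p) (τ (suc p)) (stays p p<L) a₂-edge ¬forward))

    π : Fin (suc L) → CylVertex r g
    π q = π′ (toℕ q)

    adjacent-at : ∀ p → p < L → CylAdj (π′ p) (π′ (suc p))
    adjacent-at p p<L = [ (λ a₁-edge → inj₂ (vertical-at p a₁-edge)) , (λ a₂-edge → inj₁ (horizontal-at p p<L a₂-edge)) ]′ (edges p p<L)

    horizontal≡a₂-edge : ∀ p → p < L → 𝟙 (does (horiz? (π′ p) (π′ (suc p)))) ≡ 𝟙 (does (edge? a₂ (τ p) (τ (suc p))))
    horizontal≡a₂-edge p p<L = cong 𝟙 ([ by-a₁ , by-a₂ ]′ (edges p p<L))
      where
      by-a₁ : Edge a₁ (τ p) (τ (suc p)) → does (horiz? (π′ p) (π′ (suc p))) ≡ does (edge? a₂ (τ p) (τ (suc p)))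
      by-a₁ a₁-edge =
        trans (dec-false (horiz? (π′ p) (π′ (suc p))) (λ horizontal → horizontal⇒col≢ horizontal (proj₁ (vertical-at p a₁-edge))))
                            (sym (dec-false (edge? a₂ _ _) (¬a₁-edge×a₂-edge _ _ a₁-edge)))
      by-a₂ : Edge a₂ (τ p) (τ (suc p)) → does (horiz? (π′ p) (π′ (suc p))) ≡ does (edge? a₂ (τ p) (τ (suc p)))
      by-a₂ a₂-edge = trans (dec-true (horiz? (π′ p) (π′ (suc p))) (horizontal-at p p<L a₂-edge)) (sym (dec-true (edge? a₂ _ _) a₂-edge))

    π-injective : Injective _≡_ _≡_ π
    π-injective {q} {q′} eq = toℕ-injective (τ-injective _ _ (toℕ<n q) (toℕ<n q′) (mod-injective-< (τ<n _) (τ<n _) (begin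
      + τ (toℕ q)                   ≈⟨ shift-back (τ (toℕ q)) ⟨
      + shift (τ (toℕ q)) + + τ 0   ≈⟨ +-congʳ-mod (+ τ 0) (cell-injective _ _ eq) ⟩
      + shift (τ (toℕ q′)) + + τ 0  ≈⟨ shift-back (τ (toℕ q′)) ⟩
      + τ (toℕ q′)                  ∎)))
      where open ≡-mod-Reasoning n

    starts-at-origin : R 0 ≡ 0 × C 0 ≡ 0
    starts-at-origin = coordinates-unique 0<r 0<g (mod-sym shift-first)

    ends-at-corner : R L ≡ x × C L ≡ g ∸ 1
    ends-at-corner = coordinates-unique x<r (ℕ.≤-reflexive (ℕ.suc-pred g))
                       (+-cancelʳ-mod (+ a₂) (mod-trans Φ-end+a₂≡0 (mod-sym shift-closing)))

    path : HamPathCyl r g (∑[ p < L ] 𝟙 (does (edge? a₂ (τ p) (τ (suc p))))) 0 0 x (g ∸ 1)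
    path = L , trans L+1≡n (sym r*g≡n) , π , π-injective , adjacent ,
           trans (cell-row _) (proj₁ starts-at-origin) , trans (cell-col _) (proj₂ starts-at-origin) ,
           trans (cell-row _) (trans (cong R (toℕ-fromℕ L)) (proj₁ ends-at-corner)) ,
           trans (cell-col _) (trans (cong C (toℕ-fromℕ L)) (proj₂ ends-at-corner)) ,
           horizontal-count
      where
      adjacent : All (λ e → CylAdj (proj₁ e) (proj₂ e)) (pathEdges L π)
      adjacent = map⁺ (tabulate⁺ λ i → subst (λ p → CylAdj (π′ p) (π′ (suc (toℕ i)))) (sym (toℕ-inject₁ i))
                                              (adjacent-at (toℕ i) (toℕ<n i)))
      horizontal-count : length (filter (λ e → horiz? (proj₁ e) (proj₂ e)) (pathEdges L π)) ≡
                         ∑[ p < L ] 𝟙 (does (edge? a₂ (τ p) (τ (suc p))))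
      horizontal-count = length-filter-map-allFin (λ e → horiz? (proj₁ e) (proj₂ e)) L _ _ λ i →
        trans (cong (λ p → 𝟙 (does (horiz? (π′ p) (π′ (suc (toℕ i)))))) (toℕ-inject₁ i))
              (horizontal≡a₂-edge (toℕ i) (toℕ<n i))

  module Tour (L : ℕ) (L+1≡n : suc L ≡ n) (σ : Fin (suc L) → Fin n) (σ-injective : Injective _≡_ _≡_ σ)
    (edges : All (λ e → CircEdge n a₁ (proj₁ e) (proj₂ e) ⊎ CircEdge n a₂ (proj₁ e) (proj₂ e)) (cycleEdges L σ)) where

    N : ℕ
    N = suc L

    position : ℕ → Fin N
    position m = fromℕ< (m%n<n m N)

    tour : ℕ → ℕ
    tour m = toℕ (σ (position m))

    tour<n : ∀ m → tour m < n
    tour<n m = toℕ<n (σ (position m))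

    tour-toℕ : ∀ q → tour (toℕ q) ≡ toℕ (σ q)
    tour-toℕ q = cong (λ q → toℕ (σ q)) (toℕ-injective (trans (toℕ-fromℕ< _) (m<n⇒m%n≡m (toℕ<n q))))

    tour-cong : ∀ a b → + a ≡ + b mod N → tour a ≡ tour b
    tour-cong a b a≡b = cong (λ q → toℕ (σ q)) (fromℕ<-cong _ _ (mod⇒%≡ N a b a≡b) _ _)

    tour-injective : ∀ a b → tour a ≡ tour b → + a ≡ + b mod N
    tour-injective a b eq = %≡⇒mod N a b
      (trans (sym (toℕ-fromℕ< _)) (trans (cong toℕ (σ-injective (toℕ-injective eq))) (toℕ-fromℕ< _)))

    tour-periodic : ∀ m → tour (m ℕ.+ N) ≡ tour m
    tour-periodic m = tour-cong _ _ (ℕ⇒mod (m ℕ.+ N) m 1 (cong (m ℕ.+_) (sym (ℕ.*-identityˡ N))))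

    Step : ℕ → Set
    Step m = Edge a₁ (tour m) (tour (suc m)) ⊎ Edge a₂ (tour m) (tour (suc m))

    step-cong : ∀ a b → + a ≡ + b mod N → Step a → Step b
    step-cong a b a≡b = subst₂ (λ u w → Edge a₁ u w ⊎ Edge a₂ u w) (tour-cong a b a≡b) (tour-cong (suc a) (suc b) (+-congˡ-mod (+ 1) a≡b))

    step-at : ∀ m → Step m
    step-at m = step-cong (m % N) m (%≡-mod N m) (step-below (m % N) (m%n<n m N))
      where
      path-steps : ∀ i → CircEdge n a₁ (σ (inject₁ i)) (σ (fsuc i)) ⊎ CircEdge n a₂ (σ (inject₁ i)) (σ (fsuc i))
      path-steps = tabulate⁻ (map⁻ (proj₁ (++⁻ (map (λ i → σ (inject₁ i) , σ (fsuc i)) (allFin L)) edges)))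
      closing-step : CircEdge n a₁ (σ (fromℕ L)) (σ fzero) ⊎ CircEdge n a₂ (σ (fromℕ L)) (σ fzero)
      closing-step with proj₂ (++⁻ (map (λ i → σ (inject₁ i) , σ (fsuc i)) (allFin L)) edges)
      ... | closing ∷ _ = closing
      step-below : ∀ m → m < N → Step m
      step-below m m<N with ℕ.m<1+n⇒m<n∨m≡n m<N
      ... | inj₁ m<L = subst₂ (λ u w → Edge a₁ u w ⊎ Edge a₂ u w)
          (trans (sym (tour-toℕ (inject₁ i))) (cong tour (trans (toℕ-inject₁ i) (toℕ-fromℕ< m<L))))
          (trans (sym (tour-toℕ (fsuc i))) (cong (λ m → tour (suc m)) (toℕ-fromℕ< m<L)))
          (path-steps i)
        where
        i : Fin L
        i = fromℕ< m<L
      ... | inj₂ refl = subst₂ (λ u w → Edge a₁ u w ⊎ Edge a₂ u w)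
          (trans (sym (tour-toℕ (fromℕ L))) (cong tour (toℕ-fromℕ L)))
          (trans (sym (tour-toℕ fzero)) (sym (tour-periodic 0)))
          closing-step

    a₂-at : ℕ → ℕ
    a₂-at m = 𝟙 (does (edge? a₂ (tour m) (tour (suc m))))

    a₂-at-periodic : ∀ m → a₂-at (m ℕ.+ N) ≡ a₂-at m
    a₂-at-periodic m = cong₂ (λ u w → 𝟙 (does (edge? a₂ u w))) (tour-periodic m) (tour-periodic (suc m))

    cost≡∑a₂-at : length (filter (λ e → circEdge? n a₂ (proj₁ e) (proj₂ e)) (cycleEdges L σ)) ≡ ∑ N a₂-at
    cost≡∑a₂-at = begin
      length (filter a₂? (cycleEdges L σ))                                          ≡⟨ length-filter-snoc a₂? (pathEdges L σ) _ ⟩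
      length (filter a₂? (pathEdges L σ)) ℕ.+ 𝟙 (does (a₂? (σ (fromℕ L) , σ fzero))) ≡⟨ cong₂ ℕ._+_ path-part closing-part ⟩
      ∑ L a₂-at ℕ.+ a₂-at L                                                          ≡⟨ ∑-snoc L a₂-at ⟨
      ∑ N a₂-at                                                                      ∎
      where
      open ≡-Reasoning
      a₂? : Decidable (λ (e : Fin n × Fin n) → CircEdge n a₂ (proj₁ e) (proj₂ e))
      a₂? e = circEdge? n a₂ (proj₁ e) (proj₂ e)
      path-part : length (filter a₂? (pathEdges L σ)) ≡ ∑ L a₂-at
      path-part = length-filter-map-allFin a₂? L _ a₂-at λ i →
        cong₂ (λ u w → 𝟙 (does (edge? a₂ u w)))
              (trans (sym (tour-toℕ (inject₁ i))) (cong tour (toℕ-inject₁ i))) (sym (tour-toℕ (fsuc i)))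
      closing-part : 𝟙 (does (a₂? (σ (fromℕ L) , σ fzero))) ≡ a₂-at L
      closing-part = cong₂ (λ u w → 𝟙 (does (edge? a₂ u w)))
        (trans (sym (tour-toℕ (fromℕ L))) (cong tour (toℕ-fromℕ L))) (trans (sym (tour-toℕ fzero)) (sym (tour-periodic 0)))

    column-visited : ∀ j → j < g → ∃ λ m → m < N × col (tour m) ≡ j
    column-visited j j<g with injective⇒surjective σ σ-injective L+1≡n (fromℕ< (Φ%<n 0 j))
    ... | q , σq≡ = toℕ q , toℕ<n q , proj₂ (coordinates-unique 0<r j<g (mod-trans (mod-sym (Φ%≡Φ 0 j))
                          (≡⇒≡-mod (cong +_ (sym (trans (tour-toℕ q) (trans (cong toℕ σq≡) (toℕ-fromℕ< _))))))))

    leaving : ℕ → ℕ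
    leaving t = ∑[ m < N ] 𝟙 (leaves-column t (tour m) (tour (suc m)))

    ∑leaving≡∑a₂-at : ∑ g leaving ≡ ∑ N a₂-at
    ∑leaving≡∑a₂-at =
      trans (∑-swap g N (λ t m → 𝟙 (leaves-column t (tour m) (tour (suc m))))) (∑-cong N (λ m _ → one-tail m))
      where
      one-tail : ∀ m → ∑[ t < g ] 𝟙 (leaves-column t (tour m) (tour (suc m))) ≡ a₂-at m
      one-tail m = begin
        ∑[ t < g ] 𝟙 (e ∧ does (tail ℕ.≟ t))         ≡⟨ ∑-cong g (λ t _ → 𝟙-∧ e _) ⟩
        ∑[ t < g ] (𝟙 e ℕ.* 𝟙 (does (tail ℕ.≟ t)))    ≡⟨ ∑-*ˡ g (𝟙 e) _ ⟩
        𝟙 e ℕ.* (∑[ t < g ] 𝟙 (does (tail ℕ.≟ t)))   ≡⟨ cong (𝟙 e ℕ.*_) (∑𝟙≟≡1 g tail (tail-col<g (tour m) (tour (suc m)))) ⟩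
        𝟙 e ℕ.* 1                                   ≡⟨ ℕ.*-identityʳ (𝟙 e) ⟩
        a₂-at m                                     ∎
        where
        open ≡-Reasoning
        e : Bool
        e = does (edge? a₂ (tour m) (tour (suc m)))
        tail : ℕ
        tail = tail-col (tour m) (tour (suc m))

    band : ℕ → ℕ → ℕ → Bool
    band p q m = in-interval p q (col (tour m))

    changes-band : ∀ p q → p < q → q < g → changes (band p q) N ≡ leaving p ℕ.+ leaving q
    changes-band p q p<q q<g =
      trans (∑-cong N (λ m _ → crossing (tour m) (tour (suc m)) p<q q<g (step-at m)))
            (∑-+ N (λ m → 𝟙 (leaves-column p (tour m) (tour (suc m)))) (λ m → 𝟙 (leaves-column q (tour m) (tour (suc m)))))

    leaving-pairs-even : ∀ p q → p < q → q < g → 2 ∣ leaving p ℕ.+ leaving q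
    leaving-pairs-even p q p<q q<g =
      subst (2 ∣_) (changes-band p q p<q q<g) (changes-even (band p q) N (cong (λ v → in-interval p q (col v)) (tour-periodic 0)))

    -- Some vertex lies in column q, inside the band (p, q], and some in column p, outside it.
    leaving-not-both-0 : ∀ p q → p < q → q < g → leaving p ≡ 0 → leaving q ≡ 0 → ⊥
    leaving-not-both-0 p q p<q q<g none-p none-q = true≢false (begin
      true                  ≡⟨ inside ⟨
      band p q m-in         ≡⟨ constant m-in (ℕ.<⇒≤ (proj₁ (proj₂ visit-q))) ⟩
      band p q 0            ≡⟨ constant m-out (ℕ.<⇒≤ (proj₁ (proj₂ visit-p))) ⟨
      band p q m-out        ≡⟨ outside ⟩
      false                 ∎)
      where
      open ≡-Reasoning
      true≢false : true ≢ false
      true≢false ()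
      constant : ∀ m → m ≤ N → band p q m ≡ band p q 0
      constant = changes≡0⇒constant (band p q) N (trans (changes-band p q p<q q<g) (cong₂ ℕ._+_ none-p none-q))
      visit-q : ∃ λ m → m < N × col (tour m) ≡ q
      visit-q = column-visited q q<g
      visit-p : ∃ λ m → m < N × col (tour m) ≡ p
      visit-p = column-visited p (ℕ.<-trans p<q q<g)
      m-in m-out : ℕ
      m-in = proj₁ visit-q
      m-out = proj₁ visit-p
      inside : band p q m-in ≡ true
      inside = trans (cong (in-interval p q) (proj₂ (proj₂ visit-q)))
                     (cong₂ _∧_ (dec-true (p ℕ.<? q) p<q) (dec-true (q ℕ.≤? q) ℕ.≤-refl))
      outside : band p q m-out ≡ false
      outside = trans (cong (in-interval p q) (proj₂ (proj₂ visit-p)))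
                      (cong (_∧ does (p ℕ.≤? q)) (dec-false (p ℕ.<? p) (ℕ.<-irrefl refl)))

    single-leaving-column : ∑ N a₂-at < 2 ℕ.* (g ∸ 1) → 3 ≤ g × ∃ λ t → t < g × leaving t ≡ 1
    single-leaving-column small =
      small-total⇒some≡1 g leaving leaving-pairs-even leaving-not-both-0 (subst (_< 2 ℕ.* (g ∸ 1)) (sym ∑leaving≡∑a₂-at) small)

    module Exit (3≤g : 3 ≤ g) (t : ℕ) (leaving-t≡1 : leaving t ≡ 1) where

      exit : ∃ λ M → M < N × leaves-column t (tour M) (tour (suc M)) ≡ true ×
                     (∀ m → m < N → leaves-column t (tour m) (tour (suc m)) ≡ true → m ≡ M)
      exit = ∑𝟙≡1⇒unique N (λ m → leaves-column t (tour m) (tour (suc m))) leaving-t≡1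

      M : ℕ
      M = proj₁ exit

      exit-edge : Edge a₂ (tour M) (tour (suc M))
      exit-edge = proj₁ (leaves-column⇒ t _ _ (proj₁ (proj₂ (proj₂ exit))))

      exit-tail : tail-col (tour M) (tour (suc M)) ≡ t
      exit-tail = proj₂ (leaves-column⇒ t _ _ (proj₁ (proj₂ (proj₂ exit))))

      a₂-at-M≡1 : a₂-at M ≡ 1
      a₂-at-M≡1 = cong 𝟙 (dec-true (edge? a₂ (tour M) (tour (suc M))) exit-edge)

      stays-elsewhere : ∀ d → 0 < d → d < N → leaves-column t (tour (d ℕ.+ M)) (tour (suc (d ℕ.+ M))) ≡ false
      stays-elsewhere d 0<d d<N with leaves-column t (tour (d ℕ.+ M)) (tour (suc (d ℕ.+ M))) in leaves
      ... | false = refl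
      ... | true = ⊥-elim (ℕ.<-irrefl (sym d≡0) 0<d)
        where
        reduced : (d ℕ.+ M) % N ≡ M
        reduced = proj₂ (proj₂ (proj₂ exit)) ((d ℕ.+ M) % N) (m%n<n (d ℕ.+ M) N)
          (trans (cong₂ (leaves-column t) (tour-cong _ _ (%≡-mod N (d ℕ.+ M)))
                                          (tour-cong _ _ (+-congˡ-mod (+ 1) (%≡-mod N (d ℕ.+ M)))))
                 leaves)
        d≡0 : d ≡ 0
        d≡0 = mod-injective-< d<N (ℕ.<-≤-trans 0<d (ℕ.<⇒≤ d<N)) (+-cancelʳ-mod (+ M) (begin
          + d + + M       ≡⟨ ℤ.pos-+ d M ⟨
          + (d ℕ.+ M)     ≈⟨ %≡-mod N (d ℕ.+ M) ⟨
          + ((d ℕ.+ M) % N) ≡⟨ cong +_ reduced ⟩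
          + M             ≡⟨ ℤ.+-identityˡ (+ M) ⟨
          + 0 + + M       ∎))
          where open ≡-mod-Reasoning N

      rotated-cost : suc (∑[ p < L ] a₂-at (suc p ℕ.+ M)) ≡ ∑ N a₂-at
      rotated-cost = begin
        suc (∑[ p < L ] a₂-at (suc p ℕ.+ M))       ≡⟨ cong (ℕ._+ ∑[ p < L ] a₂-at (suc p ℕ.+ M)) a₂-at-M≡1 ⟨
        ∑[ p < N ] a₂-at (p ℕ.+ M)                 ≡⟨ ∑-rotate N a₂-at a₂-at-periodic M ⟩
        ∑ N a₂-at                                  ∎
        where open ≡-Reasoning

      -- The cycle traverses its exit edge either as + a₂ (Forward) or as − a₂ (Backward); in
      -- the second case the path runs through the cycle backwards.
      module Forward (forward : StepMod n a₂ (tour M) (tour (suc M))) where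

        τ : ℕ → ℕ
        τ p = tour (suc p ℕ.+ M)

        τ-injective : ∀ p p′ → p < N → p′ < N → τ p ≡ τ p′ → p ≡ p′
        τ-injective p p′ p<N p′<N τp≡τp′ = mod-injective-< p<N p′<N
          (+-cancelˡ-mod (+ 1) (+-cancelʳ-mod (+ M) (begin
            + 1 + + p + + M         ≡⟨ ℤ.pos-+ (suc p) M ⟨
            + (suc p ℕ.+ M)         ≈⟨ tour-injective _ _ τp≡τp′ ⟩
            + (suc p′ ℕ.+ M)        ≡⟨ ℤ.pos-+ (suc p′) M ⟩
            + 1 + + p′ + + M        ∎)))
          where open ≡-mod-Reasoning N

        closing : StepMod n a₂ (τ L) (τ 0)
        closing = subst (λ u → StepMod n a₂ u (τ 0)) (sym (trans (cong tour (ℕ.+-comm N M)) (tour-periodic M))) forward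

        closing-col : col (τ L) ≡ t
        closing-col = trans (cong col (trans (cong tour (ℕ.+-comm N M)) (tour-periodic M)))
                            (trans (sym (tail-col-forward _ _ forward)) exit-tail)

        path : HamPathCyl r g (∑[ p < L ] a₂-at (suc p ℕ.+ M)) 0 0 x (g ∸ 1)
        path = CutPath.path L L+1≡n τ (λ p → tour<n (suc p ℕ.+ M)) τ-injective t
                 (λ p _ → step-at (suc p ℕ.+ M)) (λ p p<L → stays-elsewhere (suc p) ℕ.z<s (ℕ.s<s p<L))
                 closing closing-col

      module Backward (¬forward : ¬ StepMod n a₂ (tour M) (tour (suc M))) where

        backward : StepMod n a₂ (tour (suc M)) (tour M)
        backward = a₂-edge-backward _ _ exit-edge ¬forward

        τ : ℕ → ℕ
        τ p = tour (N ∸ p ℕ.+ M)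

        τ-unfold : ∀ p → p ≤ L → τ p ≡ tour (suc (L ∸ p ℕ.+ M))
        τ-unfold p p≤L = cong (λ d → tour (d ℕ.+ M)) (ℕ.+-∸-assoc 1 p≤L)

        τ-injective : ∀ p p′ → p < N → p′ < N → τ p ≡ τ p′ → p ≡ p′
        τ-injective p p′ p<N p′<N τp≡τp′ = mod-injective-< p<N p′<N
          (∸-cancel-mod (ℕ.<⇒≤ p<N) (ℕ.<⇒≤ p′<N) (+-cancelʳ-mod (+ M) (begin
            + (N ∸ p) + + M         ≡⟨ ℤ.pos-+ (N ∸ p) M ⟨
            + (N ∸ p ℕ.+ M)         ≈⟨ tour-injective _ _ τp≡τp′ ⟩
            + (N ∸ p′ ℕ.+ M)        ≡⟨ ℤ.pos-+ (N ∸ p′) M ⟩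
            + (N ∸ p′) + + M        ∎)))
          where open ≡-mod-Reasoning N

        reversed-step : ∀ p → p < L → Edge a₁ (τ p) (τ (suc p)) ⊎ Edge a₂ (τ p) (τ (suc p))
        reversed-step p p<L = subst (λ u → Edge a₁ u (τ (suc p)) ⊎ Edge a₂ u (τ (suc p))) (sym (τ-unfold p (ℕ.<⇒≤ p<L)))
          ([ (λ a₁-edge → inj₁ (Edge-sym a₁-edge)) , (λ a₂-edge → inj₂ (Edge-sym a₂-edge)) ]′ (step-at (L ∸ p ℕ.+ M)))

        reversed-stays : ∀ p → p < L → leaves-column t (τ p) (τ (suc p)) ≡ false
        reversed-stays p p<L = begin
          leaves-column t (τ p) (τ (suc p))        ≡⟨ cong (λ u → leaves-column t u (τ (suc p))) (τ-unfold p (ℕ.<⇒≤ p<L)) ⟩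
          leaves-column t (tour (suc m)) (tour m)  ≡⟨ leaves-column-sym 3≤g t (tour (suc m)) (tour m) ⟩
          leaves-column t (tour m) (tour (suc m))  ≡⟨ stays-elsewhere (L ∸ p) (ℕ.m<n⇒0<n∸m p<L) (ℕ.s≤s (ℕ.m∸n≤m L p)) ⟩
          false                                    ∎
          where
          open ≡-Reasoning
          m : ℕ
          m = L ∸ p ℕ.+ M

        τ-L : τ L ≡ tour (suc M)
        τ-L = cong (λ d → tour (d ℕ.+ M)) (ℕ.m+n∸n≡m 1 L)

        τ-0 : τ 0 ≡ tour M
        τ-0 = trans (cong tour (ℕ.+-comm N M)) (tour-periodic M)

        closing : StepMod n a₂ (τ L) (τ 0)
        closing = subst₂ (StepMod n a₂) (sym τ-L) (sym τ-0) backward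

        closing-col : col (τ L) ≡ t
        closing-col = trans (cong col τ-L) (trans (sym (tail-col-backward _ _ ¬forward)) exit-tail)

        reversed-cost : ∑[ p < L ] 𝟙 (does (edge? a₂ (τ p) (τ (suc p)))) ≡ ∑[ p < L ] a₂-at (suc p ℕ.+ M)
        reversed-cost = begin
          ∑[ p < L ] 𝟙 (does (edge? a₂ (τ p) (τ (suc p))))   ≡⟨ ∑-cong L (λ p p<L → cong 𝟙 (trans
                                                                   (cong (λ u → does (edge? a₂ u (τ (suc p)))) (τ-unfold p (ℕ.<⇒≤ p<L)))
                                                                   (edge?-sym a₂ (tour (suc (L ∸ p ℕ.+ M))) (tour (L ∸ p ℕ.+ M))))) ⟩
          ∑[ p < L ] a₂-at (L ∸ p ℕ.+ M)                     ≡⟨ ∑-reverse L (λ q → a₂-at (q ℕ.+ M)) ⟩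
          ∑[ p < L ] a₂-at (suc p ℕ.+ M)                     ∎
          where open ≡-Reasoning

        path : HamPathCyl r g (∑[ p < L ] 𝟙 (does (edge? a₂ (τ p) (τ (suc p))))) 0 0 x (g ∸ 1)
        path = CutPath.path L L+1≡n τ (λ p → tour<n (N ∸ p ℕ.+ M)) τ-injective t
                 reversed-step reversed-stays closing closing-col

      cylinder-path : Σ ℕ (λ h → suc h ≡ ∑ N a₂-at × HamPathCyl r g h 0 0 x (g ∸ 1))
      cylinder-path with stepMod? n a₂ (tour M) (tour (suc M))
      ... | yes forward = _ , rotated-cost , Forward.path forward
      ... | no ¬forward = _ , trans (cong suc (Backward.reversed-cost ¬forward)) rotated-cost , Backward.path ¬forward

  cycle⇒path : ∀ {k} → k < 2 ℕ.* (g ∸ 1) → HamCycleOfCost n a₁ a₂ k →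
               Σ ℕ (λ h → suc h ≡ k × HamPathCyl r g h 0 0 x (g ∸ 1))
  cycle⇒path {k} k<2[g-1] (L , L+1≡n , σ , σ-injective , edges , cost) =
    proj₁ cut , trans (proj₁ (proj₂ cut)) ∑a₂-at≡k , proj₂ (proj₂ cut)
    where
    open Tour L L+1≡n σ σ-injective edges
    ∑a₂-at≡k : ∑ N a₂-at ≡ k
    ∑a₂-at≡k = trans (sym cost≡∑a₂-at) cost
    single : 3 ≤ g × ∃ λ t → t < g × leaving t ≡ 1
    single = single-leaving-column (subst (_< 2 ℕ.* (g ∸ 1)) (sym ∑a₂-at≡k) k<2[g-1])
    cut : Σ ℕ (λ h → suc h ≡ ∑ N a₂-at × HamPathCyl r g h 0 0 x (g ∸ 1))
    cut = Exit.cylinder-path (proj₁ single) (proj₁ (proj₂ single)) (proj₂ (proj₂ (proj₂ single)))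

open import Data.Nat using (_+_; _*_; _/_)
open import Data.Nat.GCD using (gcd-GCD)
open import Data.Product using (Σ; _×_; _,_)
open import Function.Bundles using (_⇔_; mk⇔)
open import Defs

theorem2 : (n a₁ a₂ : ℕ)
    → 1 ≤ a₁ → a₁ ≤ n / 2 → 1 ≤ a₂ → a₂ ≤ n / 2 → a₁ ≢ a₂
    → 1 < gcd n a₁
    → gcd (gcd n a₁) a₂ ≡ 1
    → (r : ℕ) → r * gcd n a₁ ≡ n
    → (k : ℕ) → k < 2 * (gcd n a₁ ∸ 1)
    → (x : ℕ) → x < r → n ∣ x * a₁ + gcd n a₁ * a₂
    → HamCycleOfCost n a₁ a₂ k
    ⇔ Σ ℕ (λ h → suc h ≡ k × HamPathCyl r (gcd n a₁) h 0 0 x (gcd n a₁ ∸ 1))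
theorem2 n a₁ a₂ 1≤a₁ a₁≤n/2 1≤a₂ a₂≤n/2 a₁≢a₂ 1<g g⊥a₂ r r*g≡n k k<2[g-1] x x<r n∣xa₁+ga₂ =
  mk⇔ (cycle⇒path k<2[g-1]) λ (h , 1+h≡k , path) → subst (HamCycleOfCost n a₁ a₂) 1+h≡k (path⇒cycle path)
  where
  open TwoStripe n a₁ a₂ 1≤a₁ a₁≤n/2 1≤a₂ a₂≤n/2 a₁≢a₂ (gcd n a₁) (gcd-GCD n a₁) 1<g g⊥a₂
                 r r*g≡n x x<r n∣xa₁+ga₂
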